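{- Let $m\ge1$. Let $\widehat{\mathcal W}_i$, $\widehat{\mathcal W}^*_i$ and $\widehat{\mathcal B}_i$ be the subsets of $\mathcal W_i$, $\mathcal W^*_i$ and $\mathcal B_i$ consisting of trees in which all vertex degrees are multiples of $m$. Then there is a degree-preserving bijection between $\widehat{\mathcal W}_{m-1}$ and the disjoint union $\widehat{\mathcal W}^*_{m-1}\cup\widehat{\mathcal B}_{m+1}$.
   Context: All maps are planar, connected, considered up to orientation-preserving homeomorphism, and bipartite: vertices are black or white and each edge joins a black and a white vertex. Maps may carry half-edges attached to single vertices and lying in the infinite face. A half-edge at a white vertex is a leaf; one at a black vertex is a bud. Maps are rooted at a half-edge. Degrees count edges and half-edges. Degree-preserving means preserving the pair of multisets of degrees of white and of black vertices. A tree is such a map with a single face. Its charge is the number of leaves minus the number of buds, not counting the root half-edge; the total charge counts it. For an edge $e$ of a tree $T$, cutting $e$ into a leaf at its white end and a bud at its black end yields $T_e^\bullet$ (containing the black end) and $T_e^\circ$ (containing the white end), each rooted at its new half-edge. The lower subtree at $e$ is the one not containing the root. A blossom tree is a tree such that, for every edge $e$: the lower subtree has charge $\ge0$ if it is $T_e^\circ$, and $\le1$ if it is $T_e^\bullet$. For a tree of total charge $k\ge1$, go counterclockwise around it and repeatedly match a bud immediately followed (among still unmatched half-edges in the cyclic order) by a leaf. The $k$ leaves left unmatched are single. A tree rooted at a leaf is balanced if its root is single. $\mathcal W_i$ is the set of blossom trees of charge $i$ rooted at a leaf. $\mathcal B_i$ is the set of blossom trees of charge $i$ rooted at a bud. $\mathcal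 W_i^*$ is the set of balanced trees in $\mathcal W_i$. -}

module Defs where

open import Data.Nat using (ℕ; suc) renaming (_≤_ to _≤ℕ_)
open import Data.Nat.Divisibility using (_∣_)
open import Data.Integer using (ℤ; +_; _+_; _-_; _≤_; 0ℤ; 1ℤ; -1ℤ)
open import Data.List using (List; []; _∷_; _++_; length)
open import Data.List.Relation.Unary.All using (All)
open import Data.List.Membership.Propositional using (_∈_)
open import Data.List.Relation.Binary.Permutation.Propositional using (_↭_)
open import Data.Maybe using (Maybe; nothing; just)
open import Data.Product using (Σ; ∃; _×_; _,_; proj₁; proj₂)
open import Data.Sum using (_⊎_; inj₁; inj₂)
open import Data.Unit using (⊤)
open import Relation.Nullary using (¬_)
open import Relation.Binary.PropositionalEquality using (_≡_)
open import Relation.Binary.Construct.Closure.ReflexiveTransitive using (Star)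

-- A plane tree rooted at a half-edge is encoded canonically by the
-- vertex carrying the root half-edge, together with the list of the
-- other incidences of that vertex in counterclockwise order starting
-- right after the root.  Each incidence is either a half-edge
-- ('nothing') or an edge to a child vertex of the other colour
-- ('just child').  A child vertex is in turn encoded by the list of
-- its incidences in counterclockwise order starting right after the
-- edge to its parent.
--
--   W : a (sub)tree whose top vertex is white
--       (a tree rooted at a LEAF is an element of W)
--   B : a (sub)tree whose top vertex is black
--       (a tree rooted at a BUD is an element of B)
-- A half-edge at a white vertex is a leaf, at a black vertex a bud.

data W : Set
data B : Set

data W where
  w : List (Maybe B) → W

data B where
  b : List (Maybe W) → B

-- Charge: leaves minus buds, not counting the root half-edge
-- (the root half-edge is never part of the encoding).

mutual
  chW : W → ℤ
  chW (w xs) = chWs xs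

  chWs : List (Maybe B) → ℤ
  chWs []             = 0ℤ
  chWs (nothing ∷ xs) = 1ℤ + chWs xs
  chWs (just t ∷ xs)  = chB t + chWs xs

  chB : B → ℤ
  chB (b xs) = chBs xs

  chBs : List (Maybe W) → ℤ
  chBs []             = 0ℤ
  chBs (nothing ∷ xs) = -1ℤ + chBs xs
  chBs (just t ∷ xs)  = chW t + chBs xs

-- total charge of a tree rooted at a leaf (the root is a leaf)
totalChargeW : W → ℤ
totalChargeW t = chW t + 1ℤ

-- For an edge e, the lower subtree is the child
-- subtree below e, rooted at the new half-edge.  If the child is white
-- the lower subtree is T_e^∘ and must have charge ≥ 0; if the child is
-- black the lower subtree is T_e^• and must have charge ≤ 1.

mutual
  BlossomW : W → Set
  BlossomW (w xs) = BlossomWs xs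

  BlossomWs : List (Maybe B) → Set
  BlossomWs []             = ⊤
  BlossomWs (nothing ∷ xs) = BlossomWs xs
  BlossomWs (just t ∷ xs)  = (chB t ≤ 1ℤ) × BlossomB t × BlossomWs xs

  BlossomB : B → Set
  BlossomB (b xs) = BlossomBs xs

  BlossomBs : List (Maybe W) → Set
  BlossomBs []             = ⊤
  BlossomBs (nothing ∷ xs) = BlossomBs xs
  BlossomBs (just t ∷ xs)  = (0ℤ ≤ chW t) × BlossomW t × BlossomBs xs

-- Every vertex has degree 1 + (number of listed incidences): the extra
-- one is the root half-edge for the root vertex and the parent edge
-- for the other vertices.

Degs : Set
Degs = List ℕ × List ℕ

_⊕_ : Degs → Degs → Degs
(a , c) ⊕ (a' , c') = (a ++ a') , (c ++ c')

mutual
  degsW : W → Degs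
  degsW (w xs) = ((suc (length xs) ∷ []) , []) ⊕ degsWs xs

  degsWs : List (Maybe B) → Degs
  degsWs []             = [] , []
  degsWs (nothing ∷ xs) = degsWs xs
  degsWs (just t ∷ xs)  = degsB t ⊕ degsWs xs

  degsB : B → Degs
  degsB (b xs) = ([] , (suc (length xs) ∷ [])) ⊕ degsBs xs

  degsBs : List (Maybe W) → Degs
  degsBs []             = [] , []
  degsBs (nothing ∷ xs) = degsBs xs
  degsBs (just t ∷ xs)  = degsW t ⊕ degsBs xs

SameDegs : Degs → Degs → Set
SameDegs d d' = (proj₁ d ↭ proj₁ d') × (proj₂ d ↭ proj₂ d')

AllDegsDiv : ℕ → Degs → Set
AllDegsDiv m d = All (m ∣_) (proj₁ d) × All (m ∣_) (proj₂ d)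

data Sym : Set where
  bud leaf root : Sym     -- 'root' is the root half-edge (a leaf)

data IsLeaf : Sym → Set where
  isLeaf : IsLeaf leaf
  isRoot : IsLeaf root

mutual
  wordW : W → List Sym
  wordW (w xs) = wordWs xs

  wordWs : List (Maybe B) → List Sym
  wordWs []             = []
  wordWs (nothing ∷ xs) = leaf ∷ wordWs xs
  wordWs (just t ∷ xs)  = wordB t ++ wordWs xs

  wordB : B → List Sym
  wordB (b xs) = wordBs xs

  wordBs : List (Maybe W) → List Sym
  wordBs []             = []
  wordBs (nothing ∷ xs) = bud ∷ wordBs xs
  wordBs (just t ∷ xs)  = wordW t ++ wordBs xs

cycleW : W → List Sym
cycleW t = root ∷ wordW t

data MatchStep : List Sym → List Sym → Set where
  inner : ∀ as bs {l} → IsLeaf l → MatchStep (as ++ bud ∷ l ∷ bs) (as ++ bs)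
  wrap  : ∀ ms {l} → IsLeaf l → MatchStep (l ∷ ms ++ bud ∷ []) ms

Terminal : List Sym → Set
Terminal xs = ∀ ys → ¬ MatchStep xs ys

-- balanced: total charge ≥ 1 and the root is single, i.e. it is left
-- unmatched when the matching process terminates
Balanced : W → Set
Balanced t = (1ℤ ≤ totalChargeW t)
           × ∃ λ ys → Star MatchStep (cycleW t) ys × Terminal ys × root ∈ ys

WHat : ℕ → ℤ → W → Set
WHat m i t = BlossomW t × chW t ≡ i × AllDegsDiv m (degsW t)

WStarHat : ℕ → ℤ → W → Set
WStarHat m i t = WHat m i t × Balanced t

BHat : ℕ → ℤ → B → Set
BHat m i t = BlossomB t × chB t ≡ i × AllDegsDiv m (degsB t)

InUnion : ℕ → ℤ → ℤ → W ⊎ B → Set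
InUnion m i j (inj₁ t) = WStarHat m i t
InUnion m i j (inj₂ t) = BHat m j t

degsU : W ⊎ B → Degs
degsU (inj₁ t) = degsW t
degsU (inj₂ t) = degsB t

record DegPresBij (P : W → Set) (Q : W ⊎ B → Set) : Set where
  field
    to       : W → W ⊎ B
    from     : W ⊎ B → W
    to-Q     : ∀ t → P t → Q (to t)
    from-P   : ∀ u → Q u → P (from u)
    from-to  : ∀ t → P t → from (to t) ≡ t
    to-from  : ∀ u → Q u → to (from u) ≡ u
    to-degs  : ∀ t → P t → SameDegs (degsW t) (degsU (to t))

-- Rerooting a tree at a half-edge keeps all vertices and their degrees and turns the contour
-- word P s S into S s′ P.  A tree of Ŵ_{m-1} whose word has no suffix of charge -1 is balanced:
-- matching adjacent pairs inside the word leaves the root single.  Otherwise a negative suffix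
-- blocks the root from being single, and rerooting at the bud opening the shortest suffix of
-- charge -1 yields a tree of B̂_{m+1}; conversely a tree of B̂_{m+1} is rerooted at the leaf
-- where its running charge first reaches 1.  The blossom condition survives rerooting because
-- all degrees are multiples of m: every subtree then has total charge divisible by m, which
-- turns the bound on one side of an edge on the rerooting path into the bound on the other.

module Submission where

open import Defs
open import Data.Nat as ℕ using (ℕ; zero; suc; z≤n) renaming (_≤_ to _≤ℕ_)
import Data.Nat.Properties as ℕ
open import Data.Integer as ℤ using (ℤ; +_; -[1+_]; 0ℤ; 1ℤ; -1ℤ; _+_; _-_; _*_; -_; _≤_; +≤+; -≤-; -≤+)
import Data.Integer.Properties as ℤ
open import Data.Integer.Tactic.RingSolver using (solve-∀)
open import Data.Integer.Divisibility.Signed using (_∣_; ∣ᵤ⇒∣; ∣⇒∣ᵤ; ∣m∣n⇒∣m+n; ∣n⇒∣m*n)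
import Data.Nat.Divisibility as ℕ
open import Data.List using (List; []; _∷_; _++_; length)
open import Data.List.Properties using (length-++; ++-assoc; ++-identityʳ; ∷-injective; ++-monoid)
import Algebra.Solver.Monoid as MonoidSolver
import Algebra.Solver.CommutativeMonoid as CommutativeMonoidSolver
open import Algebra.Bundles using (CommutativeMonoid)
open import Algebra.Construct.DirectProduct using (commutativeMonoid)
open import Data.List.Relation.Binary.Permutation.Propositional.Properties using (++-commutativeMonoid; All-resp-↭)
import Relation.Binary.Reasoning.Setoid as SetoidReasoning
open import Data.List.Relation.Unary.All using ([]; _∷_)
import Data.List.Relation.Unary.All.Properties as All
open import Data.Maybe as Maybe using (Maybe; nothing; just)
open import Data.Product using (∃; _×_; _,_; proj₁; proj₂)
open import Data.Sum using (_⊎_; inj₁; inj₂)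
open import Data.Unit using (⊤; tt)
open import Data.Empty using (⊥-elim)
open import Function using (_⇔_; mk⇔; _∘_; module Equivalence)
open import Data.Product.Function.NonDependent.Propositional using (_×-⇔_)
open import Relation.Nullary using (¬_; Dec; yes; no)
open import Relation.Binary.Construct.Closure.ReflexiveTransitive using (Star; ε; _◅_)
open import Data.List.Membership.Propositional using (_∈_)
open import Data.List.Membership.Propositional.Properties using (∈-++⁻; ∈-++⁺ʳ; ∈-∃++)
open import Data.List.Relation.Unary.Any using (here; there)
open import Relation.Binary.PropositionalEquality using (_≡_; refl; sym; trans; cong; cong₂; subst; module ≡-Reasoning)

-- Coloured plane trees

data Colour : Set where
  white black : Colour

other : Colour → Colour
other white = black
other black = white

other-involutive : ∀ c → other (other c) ≡ c
other-involutive white = refl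
other-involutive black = refl

halfEdge : Colour → Sym
halfEdge white = leaf
halfEdge black = bud

halfCharge : Colour → ℤ
halfCharge white = 1ℤ
halfCharge black = -1ℤ

data Tree : Set where
  node : List (Maybe Tree) → Tree

Children : Set
Children = List (Maybe Tree)

children : Tree → Children
children (node xs) = xs

mutual
  fromW : W → Tree
  fromW (w xs) = node (fromWs xs)

  fromWs : List (Maybe B) → Children
  fromWs []             = []
  fromWs (nothing ∷ xs) = nothing ∷ fromWs xs
  fromWs (just t ∷ xs)  = just (fromB t) ∷ fromWs xs

  fromB : B → Tree
  fromB (b xs) = node (fromBs xs)

  fromBs : List (Maybe W) → Children
  fromBs []             = []
  fromBs (nothing ∷ xs) = nothing ∷ fromBs xs
  fromBs (just t ∷ xs)  = just (fromW t) ∷ fromBs xs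

mutual
  toW : Tree → W
  toW (node xs) = w (toWs xs)

  toWs : Children → List (Maybe B)
  toWs []             = []
  toWs (nothing ∷ xs) = nothing ∷ toWs xs
  toWs (just t ∷ xs)  = just (toB t) ∷ toWs xs

  toB : Tree → B
  toB (node xs) = b (toBs xs)

  toBs : Children → List (Maybe W)
  toBs []             = []
  toBs (nothing ∷ xs) = nothing ∷ toBs xs
  toBs (just t ∷ xs)  = just (toW t) ∷ toBs xs

mutual
  toW-fromW : ∀ t → toW (fromW t) ≡ t
  toW-fromW (w xs) = cong w (toWs-fromWs xs)

  toWs-fromWs : ∀ xs → toWs (fromWs xs) ≡ xs
  toWs-fromWs []             = refl
  toWs-fromWs (nothing ∷ xs) = cong (nothing ∷_) (toWs-fromWs xs)
  toWs-fromWs (just t ∷ xs)  = cong₂ (λ u us → just u ∷ us) (toB-fromB t) (toWs-fromWs xs)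

  toB-fromB : ∀ t → toB (fromB t) ≡ t
  toB-fromB (b xs) = cong b (toBs-fromBs xs)

  toBs-fromBs : ∀ xs → toBs (fromBs xs) ≡ xs
  toBs-fromBs []             = refl
  toBs-fromBs (nothing ∷ xs) = cong (nothing ∷_) (toBs-fromBs xs)
  toBs-fromBs (just t ∷ xs)  = cong₂ (λ u us → just u ∷ us) (toW-fromW t) (toBs-fromBs xs)

mutual
  fromW-toW : ∀ t → fromW (toW t) ≡ t
  fromW-toW (node xs) = cong node (fromWs-toWs xs)

  fromWs-toWs : ∀ xs → fromWs (toWs xs) ≡ xs
  fromWs-toWs []             = refl
  fromWs-toWs (nothing ∷ xs) = cong (nothing ∷_) (fromWs-toWs xs)
  fromWs-toWs (just t ∷ xs)  = cong₂ (λ u us → just u ∷ us) (fromB-toB t) (fromWs-toWs xs)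

  fromB-toB : ∀ t → fromB (toB t) ≡ t
  fromB-toB (node xs) = cong node (fromBs-toBs xs)

  fromBs-toBs : ∀ xs → fromBs (toBs xs) ≡ xs
  fromBs-toBs []             = refl
  fromBs-toBs (nothing ∷ xs) = cong (nothing ∷_) (fromBs-toBs xs)
  fromBs-toBs (just t ∷ xs)  = cong₂ (λ u us → just u ∷ us) (fromW-toW t) (fromBs-toBs xs)

mutual
  charge : Colour → Tree → ℤ
  charge c (node xs) = chargeL c xs

  chargeL : Colour → Children → ℤ
  chargeL c []             = 0ℤ
  chargeL c (nothing ∷ xs) = halfCharge c + chargeL c xs
  chargeL c (just t ∷ xs)  = charge (other c) t + chargeL c xs

mutual
  chW-fromW : ∀ t → chW t ≡ charge white (fromW t)
  chW-fromW (w xs) = chWs-fromWs xs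

  chWs-fromWs : ∀ xs → chWs xs ≡ chargeL white (fromWs xs)
  chWs-fromWs []             = refl
  chWs-fromWs (nothing ∷ xs) = cong (_+_ 1ℤ) (chWs-fromWs xs)
  chWs-fromWs (just t ∷ xs)  = cong₂ _+_ (chB-fromB t) (chWs-fromWs xs)

  chB-fromB : ∀ t → chB t ≡ charge black (fromB t)
  chB-fromB (b xs) = chBs-fromBs xs

  chBs-fromBs : ∀ xs → chBs xs ≡ chargeL black (fromBs xs)
  chBs-fromBs []             = refl
  chBs-fromBs (nothing ∷ xs) = cong (_+_ -1ℤ) (chBs-fromBs xs)
  chBs-fromBs (just t ∷ xs)  = cong₂ _+_ (chW-fromW t) (chBs-fromBs xs)

LowerBound : Colour → Tree → Set
LowerBound white t = 0ℤ ≤ charge white t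
LowerBound black t = charge black t ≤ 1ℤ

mutual
  Blossom : Colour → Tree → Set
  Blossom c (node xs) = Blossoms c xs

  Blossoms : Colour → Children → Set
  Blossoms c []             = ⊤
  Blossoms c (nothing ∷ xs) = Blossoms c xs
  Blossoms c (just t ∷ xs)  = LowerBound (other c) t × Blossom (other c) t × Blossoms c xs

≡⇒⇔ : ∀ {A B : Set} → A ≡ B → A ⇔ B
≡⇒⇔ refl = mk⇔ (λ a → a) (λ a → a)

mutual
  BlossomW⇔ : ∀ t → BlossomW t ⇔ Blossom white (fromW t)
  BlossomW⇔ (w xs) = BlossomWs⇔ xs

  BlossomWs⇔ : ∀ xs → BlossomWs xs ⇔ Blossoms white (fromWs xs)
  BlossomWs⇔ []             = ≡⇒⇔ refl
  BlossomWs⇔ (nothing ∷ xs) = BlossomWs⇔ xs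
  BlossomWs⇔ (just t ∷ xs)  =
    ≡⇒⇔ (cong (_≤ 1ℤ) (chB-fromB t)) ×-⇔ BlossomB⇔ t ×-⇔ BlossomWs⇔ xs

  BlossomB⇔ : ∀ t → BlossomB t ⇔ Blossom black (fromB t)
  BlossomB⇔ (b xs) = BlossomBs⇔ xs

  BlossomBs⇔ : ∀ xs → BlossomBs xs ⇔ Blossoms black (fromBs xs)
  BlossomBs⇔ []             = ≡⇒⇔ refl
  BlossomBs⇔ (nothing ∷ xs) = BlossomBs⇔ xs
  BlossomBs⇔ (just t ∷ xs)  =
    ≡⇒⇔ (cong (0ℤ ≤_) (chW-fromW t)) ×-⇔ BlossomW⇔ t ×-⇔ BlossomBs⇔ xs

vertexDegs : Colour → ℕ → Degs
vertexDegs white n = (n ∷ []) , []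
vertexDegs black n = [] , (n ∷ [])

mutual
  degs : Colour → Tree → Degs
  degs c (node xs) = vertexDegs c (suc (length xs)) ⊕ degsL c xs

  degsL : Colour → Children → Degs
  degsL c []             = [] , []
  degsL c (nothing ∷ xs) = degsL c xs
  degsL c (just t ∷ xs)  = degs (other c) t ⊕ degsL c xs

length-fromWs : ∀ xs → length (fromWs xs) ≡ length xs
length-fromWs []             = refl
length-fromWs (nothing ∷ xs) = cong suc (length-fromWs xs)
length-fromWs (just _ ∷ xs)  = cong suc (length-fromWs xs)

length-fromBs : ∀ xs → length (fromBs xs) ≡ length xs
length-fromBs []             = refl
length-fromBs (nothing ∷ xs) = cong suc (length-fromBs xs)
length-fromBs (just _ ∷ xs)  = cong suc (length-fromBs xs)

mutual
  degsW-fromW : ∀ t → degsW t ≡ degs white (fromW t)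
  degsW-fromW (w xs) =
    cong₂ (λ n d → vertexDegs white (suc n) ⊕ d) (sym (length-fromWs xs)) (degsWs-fromWs xs)

  degsWs-fromWs : ∀ xs → degsWs xs ≡ degsL white (fromWs xs)
  degsWs-fromWs []             = refl
  degsWs-fromWs (nothing ∷ xs) = degsWs-fromWs xs
  degsWs-fromWs (just t ∷ xs)  = cong₂ _⊕_ (degsB-fromB t) (degsWs-fromWs xs)

  degsB-fromB : ∀ t → degsB t ≡ degs black (fromB t)
  degsB-fromB (b xs) =
    cong₂ (λ n d → vertexDegs black (suc n) ⊕ d) (sym (length-fromBs xs)) (degsBs-fromBs xs)

  degsBs-fromBs : ∀ xs → degsBs xs ≡ degsL black (fromBs xs)
  degsBs-fromBs []             = refl
  degsBs-fromBs (nothing ∷ xs) = degsBs-fromBs xs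
  degsBs-fromBs (just t ∷ xs)  = cong₂ _⊕_ (degsW-fromW t) (degsBs-fromBs xs)

mutual
  word : Colour → Tree → List Sym
  word c (node xs) = wordL c xs

  wordL : Colour → Children → List Sym
  wordL c []             = []
  wordL c (nothing ∷ xs) = halfEdge c ∷ wordL c xs
  wordL c (just t ∷ xs)  = word (other c) t ++ wordL c xs

mutual
  wordW-fromW : ∀ t → wordW t ≡ word white (fromW t)
  wordW-fromW (w xs) = wordWs-fromWs xs

  wordWs-fromWs : ∀ xs → wordWs xs ≡ wordL white (fromWs xs)
  wordWs-fromWs []             = refl
  wordWs-fromWs (nothing ∷ xs) = cong (leaf ∷_) (wordWs-fromWs xs)
  wordWs-fromWs (just t ∷ xs)  = cong₂ _++_ (wordB-fromB t) (wordWs-fromWs xs)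

  wordB-fromB : ∀ t → wordB t ≡ word black (fromB t)
  wordB-fromB (b xs) = wordBs-fromBs xs

  wordBs-fromBs : ∀ xs → wordBs xs ≡ wordL black (fromBs xs)
  wordBs-fromBs []             = refl
  wordBs-fromBs (nothing ∷ xs) = cong (bud ∷_) (wordBs-fromBs xs)
  wordBs-fromBs (just t ∷ xs)  = cong₂ _++_ (wordW-fromW t) (wordBs-fromBs xs)

-- Rerooting

Frame : Set
Frame = Children × Children

-- A focus (fs , xs , ys) on a half-edge: the frames (a , q) list, from the root down, the
-- siblings before and after the edge leading to the next vertex; xs and ys are the
-- incidences before and after the focused half-edge at its own vertex.
Focus : Set
Focus = List Frame × Children × Children

plugChildren : List Frame → Children → Children → Children
plugChildren []             xs ys = xs ++ nothing ∷ ys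
plugChildren ((a , q) ∷ fs) xs ys = a ++ just (node (plugChildren fs xs ys)) ∷ q

plug : List Frame → Children → Children → Tree
plug fs xs ys = node (plugChildren fs xs ys)

colourAt : Colour → List Frame → Colour
colourAt c []       = c
colourAt c (_ ∷ fs) = colourAt (other c) fs

-- Turns the path of frames upside down: each vertex hangs from its former child, and t takes
-- the place of the edge to its former parent (t is the old root half-edge at the top).
invertPath : List Frame → Maybe Tree → Maybe Tree
invertPath []             t = t
invertPath ((a , q) ∷ fs) t = invertPath fs (just (node (q ++ t ∷ a)))

reroot : List Frame → Children → Children → Tree
reroot fs xs ys = node (ys ++ invertPath fs nothing ∷ xs)

reverseFrames : List Frame → List Frame → List Frame
reverseFrames []             acc = acc
reverseFrames ((a , q) ∷ fs) acc = reverseFrames fs ((q , a) ∷ acc)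

oldRootFocus : List Frame → Children → Children → Focus
oldRootFocus []             xs ys = [] , ys , xs
oldRootFocus ((a , q) ∷ fs) xs ys = ((ys , xs) ∷ reverseFrames fs []) , q , a

invertPath-plug : ∀ fs gs xs ys →
  invertPath fs (just (plug gs xs ys)) ≡ just (plug (reverseFrames fs gs) xs ys)
invertPath-plug []             gs xs ys = refl
invertPath-plug ((a , q) ∷ fs) gs xs ys = invertPath-plug fs ((q , a) ∷ gs) xs ys

reverseFrames-reverseFrames : ∀ fs gs hs →
  reverseFrames (reverseFrames fs gs) hs ≡ reverseFrames gs (fs ++ hs)
reverseFrames-reverseFrames []             gs hs = refl
reverseFrames-reverseFrames ((a , q) ∷ fs) gs hs = reverseFrames-reverseFrames fs ((q , a) ∷ gs) hs

plug-oldRootFocus : ∀ fs xs ys → let (gs , us , vs) = oldRootFocus fs xs ys in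
  plug gs us vs ≡ reroot fs xs ys
plug-oldRootFocus []             xs ys = refl
plug-oldRootFocus ((a , q) ∷ fs) xs ys =
  cong (λ t → node (ys ++ t ∷ xs)) (sym (invertPath-plug fs [] q a))

reroot-oldRootFocus : ∀ fs xs ys → let (gs , us , vs) = oldRootFocus fs xs ys in
  reroot gs us vs ≡ plug fs xs ys
reroot-oldRootFocus []             xs ys = refl
reroot-oldRootFocus ((a , q) ∷ fs) xs ys = cong (λ t → node (a ++ t ∷ q)) (begin
  invertPath (reverseFrames fs []) (just (plug [] xs ys))  ≡⟨ invertPath-plug (reverseFrames fs []) [] xs ys ⟩
  just (plug (reverseFrames (reverseFrames fs []) []) xs ys) ≡⟨ cong (λ gs → just (plug gs xs ys)) reverse² ⟩
  just (plug fs xs ys)                                     ∎)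
  where
  open ≡-Reasoning
  reverse² : reverseFrames (reverseFrames fs []) [] ≡ fs
  reverse² = trans (reverseFrames-reverseFrames fs [] []) (++-identityʳ fs)

module ++-Solver = MonoidSolver (++-monoid Sym)

framesPrefix : Colour → List Frame → List Sym
framesPrefix c []             = []
framesPrefix c ((a , q) ∷ fs) = wordL c a ++ framesPrefix (other c) fs

framesSuffix : Colour → List Frame → List Sym
framesSuffix c []             = []
framesSuffix c ((a , q) ∷ fs) = framesSuffix (other c) fs ++ wordL c q

prefixWord : Colour → List Frame → Children → List Sym
prefixWord c fs xs = framesPrefix c fs ++ wordL (colourAt c fs) xs

suffixWord : Colour → List Frame → Children → List Sym
suffixWord c fs ys = wordL (colourAt c fs) ys ++ framesSuffix c fs

wordL-++ : ∀ c xs ys → wordL c (xs ++ ys) ≡ wordL c xs ++ wordL c ys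
wordL-++ c []             ys = refl
wordL-++ c (nothing ∷ xs) ys = cong (halfEdge c ∷_) (wordL-++ c xs ys)
wordL-++ c (just t ∷ xs)  ys =
  trans (cong (word (other c) t ++_) (wordL-++ c xs ys)) (sym (++-assoc (word (other c) t) _ _))

word-plug : ∀ c fs xs ys →
  word c (plug fs xs ys) ≡ prefixWord c fs xs ++ halfEdge (colourAt c fs) ∷ suffixWord c fs ys
word-plug c [] xs ys =
  trans (wordL-++ c xs (nothing ∷ ys)) (cong (λ v → wordL c xs ++ halfEdge c ∷ v) (sym (++-identityʳ _)))
word-plug c ((a , q) ∷ fs) xs ys = begin
  wordL c (a ++ just (plug fs xs ys) ∷ q)                    ≡⟨ wordL-++ c a _ ⟩
  wordL c a ++ word (other c) (plug fs xs ys) ++ wordL c q   ≡⟨ cong (λ v → wordL c a ++ v ++ wordL c q) (word-plug (other c) fs xs ys) ⟩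
  A ++ ((F ++ X) ++ s ∷ (Y ++ G)) ++ Q                       ≡⟨ solve 7 (λ A F X S Y G Q →
                                                                  A ⊛ (((F ⊛ X) ⊛ (S ⊛ (Y ⊛ G))) ⊛ Q)
                                                                ⊜ ((A ⊛ F) ⊛ X) ⊛ (S ⊛ (Y ⊛ (G ⊛ Q)))) refl
                                                                A F X (s ∷ []) Y G Q ⟩
  ((A ++ F) ++ X) ++ s ∷ (Y ++ (G ++ Q))                     ∎
  where
  open ≡-Reasoning
  open ++-Solver using (solve; _⊜_) renaming (_⊕_ to _⊛_)
  A = wordL c a
  Q = wordL c q
  F = framesPrefix (other c) fs
  G = framesSuffix (other c) fs
  X = wordL (colourAt (other c) fs) xs
  Y = wordL (colourAt (other c) fs) ys
  s = halfEdge (colourAt (other c) fs)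

wordItem : Colour → Maybe Tree → List Sym
wordItem c nothing  = halfEdge c ∷ []
wordItem c (just t) = word (other c) t

wordL-∷ : ∀ c t xs → wordL c (t ∷ xs) ≡ wordItem c t ++ wordL c xs
wordL-∷ c nothing  xs = refl
wordL-∷ c (just t) xs = refl

wordL-invertPath : ∀ c fs xs ys t →
  wordL (colourAt c fs) (ys ++ invertPath fs t ∷ xs)
    ≡ wordL (colourAt c fs) ys ++ framesSuffix c fs ++ wordItem c t ++ framesPrefix c fs ++ wordL (colourAt c fs) xs
wordL-invertPath c [] xs ys t = trans (wordL-++ c ys (t ∷ xs)) (cong (wordL c ys ++_) (wordL-∷ c t xs))
wordL-invertPath c ((a , q) ∷ fs) xs ys t = begin
  wordL c′ (ys ++ invertPath fs (just N) ∷ xs)                  ≡⟨ wordL-invertPath (other c) fs xs ys (just N) ⟩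
  Y ++ G ++ word (other (other c)) N ++ F ++ X                 ≡⟨ cong (λ c″ → Y ++ G ++ word c″ N ++ F ++ X) (other-involutive c) ⟩
  Y ++ G ++ wordL c (q ++ t ∷ a) ++ F ++ X                     ≡⟨ cong (λ v → Y ++ G ++ v ++ F ++ X) wordN ⟩
  Y ++ G ++ (Q ++ wordItem c t ++ A) ++ F ++ X                 ≡⟨ solve 7 (λ Y G Q T A F X →
                                                                    Y ⊛ (G ⊛ ((Q ⊛ (T ⊛ A)) ⊛ (F ⊛ X)))
                                                                  ⊜ Y ⊛ ((G ⊛ Q) ⊛ (T ⊛ ((A ⊛ F) ⊛ X)))) refl
                                                                  Y G Q (wordItem c t) A F X ⟩
  Y ++ (G ++ Q) ++ wordItem c t ++ (A ++ F) ++ X               ∎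
  where
  open ≡-Reasoning
  open ++-Solver using (solve; _⊜_) renaming (_⊕_ to _⊛_)
  c′ = colourAt (other c) fs
  N = node (q ++ t ∷ a)
  A = wordL c a
  Q = wordL c q
  F = framesPrefix (other c) fs
  G = framesSuffix (other c) fs
  X = wordL c′ xs
  Y = wordL c′ ys
  wordN : wordL c (q ++ t ∷ a) ≡ Q ++ wordItem c t ++ A
  wordN = trans (wordL-++ c q (t ∷ a)) (cong (Q ++_) (wordL-∷ c t a))

word-reroot : ∀ c fs xs ys →
  word (colourAt c fs) (reroot fs xs ys) ≡ suffixWord c fs ys ++ halfEdge c ∷ prefixWord c fs xs
word-reroot c fs xs ys = trans (wordL-invertPath c fs xs ys nothing)
  (solve 5 (λ Y G S F X → Y ⊛ (G ⊛ (S ⊛ (F ⊛ X))) ⊜ (Y ⊛ G) ⊛ (S ⊛ (F ⊛ X))) refl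
     (wordL (colourAt c fs) ys) (framesSuffix c fs) (halfEdge c ∷ []) (framesPrefix c fs) (wordL (colourAt c fs) xs))
  where open ++-Solver using (solve; _⊜_) renaming (_⊕_ to _⊛_)

framesPrefix-reverseFrames : ∀ c fs gs →
  framesPrefix (other (colourAt c fs)) (reverseFrames fs gs) ≡ framesSuffix c fs ++ framesPrefix (other c) gs
framesPrefix-reverseFrames c []             gs = refl
framesPrefix-reverseFrames c ((a , q) ∷ fs) gs = begin
  framesPrefix (other (colourAt (other c) fs)) (reverseFrames fs ((q , a) ∷ gs))
    ≡⟨ framesPrefix-reverseFrames (other c) fs ((q , a) ∷ gs) ⟩
  framesSuffix (other c) fs ++ wordL (other (other c)) q ++ framesPrefix (other (other (other c))) gs
    ≡⟨ cong (λ c′ → framesSuffix (other c) fs ++ wordL c′ q ++ framesPrefix (other c′) gs) (other-involutive c) ⟩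
  framesSuffix (other c) fs ++ wordL c q ++ framesPrefix (other c) gs
    ≡⟨ sym (++-assoc (framesSuffix (other c) fs) _ _) ⟩
  (framesSuffix (other c) fs ++ wordL c q) ++ framesPrefix (other c) gs
    ∎
  where open ≡-Reasoning

colourAt-reverseFrames : ∀ c fs gs → colourAt (other (colourAt c fs)) (reverseFrames fs gs) ≡ colourAt (other c) gs
colourAt-reverseFrames c []             gs = refl
colourAt-reverseFrames c ((a , q) ∷ fs) gs =
  trans (colourAt-reverseFrames (other c) fs ((q , a) ∷ gs)) (cong (λ c′ → colourAt (other c′) gs) (other-involutive c))

prefixWord-oldRootFocus : ∀ c fs xs ys → let (gs , us , vs) = oldRootFocus fs xs ys in
  prefixWord (colourAt c fs) gs us ≡ suffixWord c fs ys
prefixWord-oldRootFocus c []             xs ys = sym (++-identityʳ _)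
prefixWord-oldRootFocus c ((a , q) ∷ fs) xs ys = begin
  (Y ++ framesPrefix (other c′) (reverseFrames fs [])) ++ wordL (colourAt (other c′) (reverseFrames fs [])) q
    ≡⟨ cong₂ (λ F c″ → (Y ++ F) ++ wordL c″ q)
         (trans (framesPrefix-reverseFrames (other c) fs []) (++-identityʳ _))
         (trans (colourAt-reverseFrames (other c) fs []) (other-involutive c)) ⟩
  (Y ++ framesSuffix (other c) fs) ++ wordL c q
    ≡⟨ ++-assoc Y _ _ ⟩
  Y ++ framesSuffix (other c) fs ++ wordL c q
    ∎
  where
  open ≡-Reasoning
  c′ = colourAt (other c) fs
  Y = wordL c′ ys

-- Locating a half-edge by its position in the contour word

-- locateIn done rest n focuses on the n-th half-edge (from 0, in contour order) of the
-- children done ++ rest, skipping done; it returns inj₂ k if rest has only n - k of them.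
mutual
  locateIn : Children → Children → ℕ → Focus ⊎ ℕ
  locateIn done []                  n       = inj₂ n
  locateIn done (nothing ∷ r)       zero    = inj₁ ([] , done , r)
  locateIn done (nothing ∷ r)       (suc n) = locateIn (done ++ nothing ∷ []) r n
  locateIn done (just (node M) ∷ r) n       = locateAfter done M r (locateIn [] M n)

  locateAfter : Children → Children → Children → Focus ⊎ ℕ → Focus ⊎ ℕ
  locateAfter done M r (inj₁ (fs , xs , ys)) = inj₁ (((done , r) ∷ fs) , xs , ys)
  locateAfter done M r (inj₂ n)              = locateIn (done ++ just (node M) ∷ []) r n

length-++-+ : ∀ (A B : List Sym) k → length (A ++ B) ℕ.+ k ≡ length A ℕ.+ (length B ℕ.+ k)
length-++-+ A B k = trans (cong (ℕ._+ k) (length-++ A)) (ℕ.+-assoc (length A) (length B) k)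

locateIn-skip : ∀ c done M k → locateIn done M (length (wordL c M) ℕ.+ k) ≡ inj₂ k
locateIn-skip c done []                   k = refl
locateIn-skip c done (nothing ∷ M)        k = locateIn-skip c (done ++ nothing ∷ []) M k
locateIn-skip c done (just (node M′) ∷ M) k = begin
  locateAfter done M′ M (locateIn [] M′ (length (wordL (other c) M′ ++ wordL c M) ℕ.+ k))
    ≡⟨ cong (λ n → locateAfter done M′ M (locateIn [] M′ n)) (length-++-+ (wordL (other c) M′) _ k) ⟩
  locateAfter done M′ M (locateIn [] M′ (length (wordL (other c) M′) ℕ.+ (length (wordL c M) ℕ.+ k)))
    ≡⟨ cong (locateAfter done M′ M) (locateIn-skip (other c) [] M′ _) ⟩
  locateIn (done ++ just (node M′) ∷ []) M (length (wordL c M) ℕ.+ k)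
    ≡⟨ locateIn-skip c _ M k ⟩
  inj₂ k
    ∎
  where open ≡-Reasoning

locateIn-++ : ∀ c done a r k → locateIn done (a ++ r) (length (wordL c a) ℕ.+ k) ≡ locateIn (done ++ a) r k
locateIn-++ c done []                   r k = cong (λ d → locateIn d r k) (sym (++-identityʳ done))
locateIn-++ c done (nothing ∷ a)        r k =
  trans (locateIn-++ c (done ++ nothing ∷ []) a r k) (cong (λ d → locateIn d r k) (++-assoc done _ a))
locateIn-++ c done (just (node M′) ∷ a) r k = begin
  locateAfter done M′ (a ++ r) (locateIn [] M′ (length (wordL (other c) M′ ++ wordL c a) ℕ.+ k))
    ≡⟨ cong (λ n → locateAfter done M′ (a ++ r) (locateIn [] M′ n)) (length-++-+ (wordL (other c) M′) _ k) ⟩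
  locateAfter done M′ (a ++ r) (locateIn [] M′ (length (wordL (other c) M′) ℕ.+ (length (wordL c a) ℕ.+ k)))
    ≡⟨ cong (locateAfter done M′ (a ++ r)) (locateIn-skip (other c) [] M′ _) ⟩
  locateIn (done ++ just (node M′) ∷ []) (a ++ r) (length (wordL c a) ℕ.+ k)
    ≡⟨ locateIn-++ c _ a r k ⟩
  locateIn ((done ++ just (node M′) ∷ []) ++ a) r k
    ≡⟨ cong (λ d → locateIn d r k) (++-assoc done _ a) ⟩
  locateIn (done ++ just (node M′) ∷ a) r k
    ∎
  where open ≡-Reasoning

length-prefixWord-∷ : ∀ c a q fs xs →
  length (prefixWord c ((a , q) ∷ fs) xs) ≡ length (wordL c a) ℕ.+ length (prefixWord (other c) fs xs)
length-prefixWord-∷ c a q fs xs =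
  trans (cong length (++-assoc (wordL c a) (framesPrefix (other c) fs) _)) (length-++ (wordL c a))

locateIn-plug : ∀ c fs xs ys → locateIn [] (plugChildren fs xs ys) (length (prefixWord c fs xs)) ≡ inj₁ (fs , xs , ys)
locateIn-plug c [] xs ys =
  trans (cong (locateIn [] (xs ++ nothing ∷ ys)) (sym (ℕ.+-identityʳ _))) (locateIn-++ c [] xs (nothing ∷ ys) 0)
locateIn-plug c ((a , q) ∷ fs) xs ys = begin
  locateIn [] (a ++ just (plug fs xs ys) ∷ q) (length (prefixWord c ((a , q) ∷ fs) xs))
    ≡⟨ cong (locateIn [] (a ++ just (plug fs xs ys) ∷ q)) (length-prefixWord-∷ c a q fs xs) ⟩
  locateIn [] (a ++ just (plug fs xs ys) ∷ q) (length (wordL c a) ℕ.+ length (prefixWord (other c) fs xs))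
    ≡⟨ locateIn-++ c [] a _ _ ⟩
  locateAfter a (plugChildren fs xs ys) q (locateIn [] (plugChildren fs xs ys) (length (prefixWord (other c) fs xs)))
    ≡⟨ cong (locateAfter a _ q) (locateIn-plug (other c) fs xs ys) ⟩
  inj₁ (((a , q) ∷ fs) , xs , ys)
    ∎
  where open ≡-Reasoning

LocateSpec : Colour → Children → Children → ℕ → Focus ⊎ ℕ → Set
LocateSpec c done rest n (inj₁ (fs , xs , ys)) =
  plugChildren fs xs ys ≡ done ++ rest × length (prefixWord c fs xs) ≡ length (wordL c done) ℕ.+ n
LocateSpec c done rest n (inj₂ k) = n ≡ length (wordL c rest) ℕ.+ k

length-wordL-∷ : ∀ c t xs → length (wordL c (t ∷ xs)) ≡ length (wordItem c t) ℕ.+ length (wordL c xs)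
length-wordL-∷ c t xs = trans (cong length (wordL-∷ c t xs)) (length-++ (wordItem c t))

length-wordL-∷ʳ : ∀ c done t → length (wordL c (done ++ t ∷ [])) ≡ length (wordL c done) ℕ.+ length (wordItem c t)
length-wordL-∷ʳ c done t = begin
  length (wordL c (done ++ t ∷ []))                            ≡⟨ cong length (wordL-++ c done (t ∷ [])) ⟩
  length (wordL c done ++ wordL c (t ∷ []))                    ≡⟨ length-++ (wordL c done) ⟩
  length (wordL c done) ℕ.+ length (wordL c (t ∷ []))          ≡⟨ cong (length (wordL c done) ℕ.+_) (length-wordL-∷ c t []) ⟩
  length (wordL c done) ℕ.+ (length (wordItem c t) ℕ.+ 0)      ≡⟨ cong (length (wordL c done) ℕ.+_) (ℕ.+-identityʳ _) ⟩
  length (wordL c done) ℕ.+ length (wordItem c t)              ∎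
  where open ≡-Reasoning

LocateSpec-shift : ∀ c done t r n res →
  LocateSpec c (done ++ t ∷ []) r n res → LocateSpec c done (t ∷ r) (length (wordItem c t) ℕ.+ n) res
LocateSpec-shift c done t r n (inj₁ (fs , xs , ys)) (plug≡ , length≡) =
  trans plug≡ (++-assoc done (t ∷ []) r) ,
  trans length≡ (trans (cong (ℕ._+ n) (length-wordL-∷ʳ c done t)) (ℕ.+-assoc (length (wordL c done)) _ n))
LocateSpec-shift c done t r n (inj₂ k) n≡ =
  trans (cong (length (wordItem c t) ℕ.+_) n≡)
    (trans (sym (ℕ.+-assoc (length (wordItem c t)) _ k)) (cong (ℕ._+ k) (sym (length-wordL-∷ c t r))))

mutual
  locateIn-sound : ∀ c done rest n → LocateSpec c done rest n (locateIn done rest n)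
  locateIn-sound c done []                  n       = refl
  locateIn-sound c done (nothing ∷ r)       zero    = refl , sym (ℕ.+-identityʳ _)
  locateIn-sound c done (nothing ∷ r)       (suc n) =
    LocateSpec-shift c done nothing r n _ (locateIn-sound c (done ++ nothing ∷ []) r n)
  locateIn-sound c done (just (node M) ∷ r) n       =
    locateAfter-sound c done M r n (locateIn [] M n) (locateIn-sound (other c) [] M n)

  locateAfter-sound : ∀ c done M r n res → LocateSpec (other c) [] M n res →
    LocateSpec c done (just (node M) ∷ r) n (locateAfter done M r res)
  locateAfter-sound c done M r n (inj₁ (fs , xs , ys)) (plug≡ , length≡) =
    cong (λ N → done ++ just (node N) ∷ r) plug≡ ,
    trans (length-prefixWord-∷ c done r fs xs) (cong (length (wordL c done) ℕ.+_) length≡)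
  locateAfter-sound c done M r n (inj₂ k) refl =
    LocateSpec-shift c done (just (node M)) r k _ (locateIn-sound c (done ++ just (node M) ∷ []) r k)

++-∷-injective : ∀ {A : Set} (P C : List A) x y S D →
  length P ≡ length C → P ++ x ∷ S ≡ C ++ y ∷ D → P ≡ C × x ≡ y × S ≡ D
++-∷-injective []      []      x y S D _  eq with ∷-injective eq
... | x≡y , S≡D = refl , x≡y , S≡D
++-∷-injective (p ∷ P) (c ∷ C) x y S D len eq with ∷-injective eq
... | refl , eq′ with ++-∷-injective P C x y S D (ℕ.suc-injective len) eq′
... | refl , x≡y , S≡D = refl , x≡y , S≡D

record Located (c : Colour) (M : Children) (P : List Sym) (s : Sym) (S : List Sym) : Set where
  field
    frames      : List Frame
    before      : Children
    after       : Children
    locate≡     : locateIn [] M (length P) ≡ inj₁ (frames , before , after)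
    plug≡       : plugChildren frames before after ≡ M
    prefix≡     : prefixWord c frames before ≡ P
    halfEdge≡   : halfEdge (colourAt c frames) ≡ s
    suffix≡     : suffixWord c frames after ≡ S

locate-complete : ∀ c M P s S → wordL c M ≡ P ++ s ∷ S → Located c M P s S
locate-complete c M P s S word≡ = fromSpec (locateIn [] M (length P)) refl (locateIn-sound c [] M (length P))
  where
  fromSpec : ∀ res → locateIn [] M (length P) ≡ res → LocateSpec c [] M (length P) res → Located c M P s S
  fromSpec (inj₂ k) _ P≡ = ⊥-elim (ℕ.m+1+n≢m (length P) (sym (begin
    length P                                 ≡⟨ P≡ ⟩
    length (wordL c M) ℕ.+ k                 ≡⟨ cong (λ v → length v ℕ.+ k) word≡ ⟩
    length (P ++ s ∷ S) ℕ.+ k                ≡⟨ length-++-+ P (s ∷ S) k ⟩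
    length P ℕ.+ suc (length S ℕ.+ k)        ∎)))
    where open ≡-Reasoning
  fromSpec (inj₁ (fs , xs , ys)) locate≡ (plug≡ , length≡) =
    let (prefix≡ , halfEdge≡ , suffix≡) = ++-∷-injective _ P _ s _ S length≡
          (trans (sym (word-plug c fs xs ys)) (trans (cong (wordL c) plug≡) word≡))
    in record { locate≡ = locate≡ ; plug≡ = plug≡ ; prefix≡ = prefix≡ ; halfEdge≡ = halfEdge≡ ; suffix≡ = suffix≡ }

degsMonoid : CommutativeMonoid _ _
degsMonoid = commutativeMonoid (++-commutativeMonoid {A = ℕ}) (++-commutativeMonoid {A = ℕ})

module DegsSolver = CommutativeMonoidSolver degsMonoid
open CommutativeMonoid degsMonoid
  using (∙-congˡ; ∙-congʳ; identityʳ; assoc)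
  renaming (setoid to degsSetoid; refl to SameDegs-refl; sym to SameDegs-sym; trans to SameDegs-trans)

degsItem : Colour → Maybe Tree → Degs
degsItem c nothing  = [] , []
degsItem c (just t) = degs (other c) t

degsL-++ : ∀ c xs ys → SameDegs (degsL c (xs ++ ys)) (degsL c xs ⊕ degsL c ys)
degsL-++ c []             ys = SameDegs-refl
degsL-++ c (nothing ∷ xs) ys = degsL-++ c xs ys
degsL-++ c (just t ∷ xs)  ys = begin
  degs (other c) t ⊕ degsL c (xs ++ ys)                    ≈⟨ ∙-congˡ {degs (other c) t} (degsL-++ c xs ys) ⟩
  degs (other c) t ⊕ (degsL c xs ⊕ degsL c ys)             ≈⟨ SameDegs-sym (assoc (degs (other c) t) _ _) ⟩
  (degs (other c) t ⊕ degsL c xs) ⊕ degsL c ys             ∎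
  where open SetoidReasoning degsSetoid

degsL-insert : ∀ c xs t ys → SameDegs (degsL c (xs ++ t ∷ ys)) (degsL c xs ⊕ (degsItem c t ⊕ degsL c ys))
degsL-insert c xs nothing  ys = degsL-++ c xs (nothing ∷ ys)
degsL-insert c xs (just t) ys = degsL-++ c xs (just t ∷ ys)

length-++-∷-swap : ∀ {A : Set} (xs ys : List A) u v → length (xs ++ u ∷ ys) ≡ length (ys ++ v ∷ xs)
length-++-∷-swap xs ys u v = begin
  length (xs ++ u ∷ ys)         ≡⟨ length-++ xs ⟩
  length xs ℕ.+ suc (length ys) ≡⟨ ℕ.+-suc (length xs) (length ys) ⟩
  suc (length xs ℕ.+ length ys) ≡⟨ cong suc (ℕ.+-comm (length xs) (length ys)) ⟩
  suc (length ys ℕ.+ length xs) ≡⟨ ℕ.+-suc (length ys) (length xs) ⟨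
  length ys ℕ.+ suc (length xs) ≡⟨ length-++ ys ⟨
  length (ys ++ v ∷ xs)         ∎
  where open ≡-Reasoning

degs-invertPath : ∀ c fs xs ys t →
  SameDegs (degs (colourAt c fs) (node (ys ++ invertPath fs t ∷ xs))) (degs c (plug fs xs ys) ⊕ degsItem c t)
degs-invertPath c [] xs ys t = begin
  vertexDegs c (suc (length (ys ++ t ∷ xs))) ⊕ degsL c (ys ++ t ∷ xs)
    ≡⟨ cong (λ n → vertexDegs c (suc n) ⊕ degsL c (ys ++ t ∷ xs)) (length-++-∷-swap ys xs t nothing) ⟩
  V ⊕ degsL c (ys ++ t ∷ xs)
    ≈⟨ ∙-congˡ {V} (degsL-insert c ys t xs) ⟩
  V ⊕ (Y ⊕ (I ⊕ X))
    ≈⟨ solve 4 (λ V X Y I → V ⊕′ (Y ⊕′ (I ⊕′ X)) ⊜ (V ⊕′ (X ⊕′ Y)) ⊕′ I) SameDegs-refl V X Y I ⟩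
  (V ⊕ (X ⊕ Y)) ⊕ I
    ≈⟨ ∙-congʳ {I} (∙-congˡ {V} (SameDegs-sym (degsL-insert c xs nothing ys))) ⟩
  (V ⊕ degsL c (xs ++ nothing ∷ ys)) ⊕ I
    ∎
  where
  open SetoidReasoning degsSetoid
  open DegsSolver using (solve; _⊜_) renaming (_⊕_ to _⊕′_)
  V = vertexDegs c (suc (length (xs ++ nothing ∷ ys)))
  X = degsL c xs
  Y = degsL c ys
  I = degsItem c t
degs-invertPath c ((a , q) ∷ fs) xs ys t = begin
  degs (colourAt (other c) fs) (node (ys ++ invertPath fs (just N) ∷ xs))
    ≈⟨ degs-invertPath (other c) fs xs ys (just N) ⟩
  D ⊕ degs (other (other c)) N
    ≡⟨ cong (λ c′ → D ⊕ degs c′ N) (other-involutive c) ⟩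
  D ⊕ (vertexDegs c (suc (length (q ++ t ∷ a))) ⊕ degsL c (q ++ t ∷ a))
    ≡⟨ cong (λ n → D ⊕ (vertexDegs c (suc n) ⊕ degsL c (q ++ t ∷ a))) (length-++-∷-swap q a t (just P)) ⟩
  D ⊕ (V ⊕ degsL c (q ++ t ∷ a))
    ≈⟨ ∙-congˡ {D} (∙-congˡ {V} (degsL-insert c q t a)) ⟩
  D ⊕ (V ⊕ (Q ⊕ (I ⊕ A)))
    ≈⟨ solve 5 (λ V A D Q I → D ⊕′ (V ⊕′ (Q ⊕′ (I ⊕′ A))) ⊜ (V ⊕′ (A ⊕′ (D ⊕′ Q))) ⊕′ I)
         SameDegs-refl V A D Q I ⟩
  (V ⊕ (A ⊕ (D ⊕ Q))) ⊕ I
    ≈⟨ ∙-congʳ {I} (∙-congˡ {V} (SameDegs-sym (degsL-insert c a (just P) q))) ⟩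
  (V ⊕ degsL c (a ++ just P ∷ q)) ⊕ I
    ∎
  where
  open SetoidReasoning degsSetoid
  open DegsSolver using (solve; _⊜_) renaming (_⊕_ to _⊕′_)
  N = node (q ++ t ∷ a)
  P = plug fs xs ys
  D = degs (other c) P
  V = vertexDegs c (suc (length (a ++ just P ∷ q)))
  A = degsL c a
  Q = degsL c q
  I = degsItem c t

degs-reroot : ∀ c fs xs ys → SameDegs (degs c (plug fs xs ys)) (degs (colourAt c fs) (reroot fs xs ys))
degs-reroot c fs xs ys =
  SameDegs-sym (SameDegs-trans (degs-invertPath c fs xs ys nothing) (identityʳ _))

-- Divisibility and the blossom condition

mutual
  AllDegreesDivisible : ℕ → Tree → Set
  AllDegreesDivisible m (node xs) = m ℕ.∣ suc (length xs) × AllDegreesDivisibleL m xs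

  AllDegreesDivisibleL : ℕ → Children → Set
  AllDegreesDivisibleL m []             = ⊤
  AllDegreesDivisibleL m (nothing ∷ xs) = AllDegreesDivisibleL m xs
  AllDegreesDivisibleL m (just t ∷ xs)  = AllDegreesDivisible m t × AllDegreesDivisibleL m xs

AllDegsDiv-⊕⁻ : ∀ {m} d e → AllDegsDiv m (d ⊕ e) → AllDegsDiv m d × AllDegsDiv m e
AllDegsDiv-⊕⁻ d e (whites , blacks) =
  (All.++⁻ˡ (proj₁ d) whites , All.++⁻ˡ (proj₂ d) blacks) , (All.++⁻ʳ (proj₁ d) whites , All.++⁻ʳ (proj₂ d) blacks)

AllDegsDiv-vertexDegs : ∀ {m} c n → AllDegsDiv m (vertexDegs c n) → m ℕ.∣ n
AllDegsDiv-vertexDegs white n ((m∣n ∷ []) , _) = m∣n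
AllDegsDiv-vertexDegs black n (_ , (m∣n ∷ [])) = m∣n

AllDegsDiv-resp-SameDegs : ∀ {m d e} → SameDegs d e → AllDegsDiv m d → AllDegsDiv m e
AllDegsDiv-resp-SameDegs (whites↭ , blacks↭) (whites , blacks) = All-resp-↭ whites↭ whites , All-resp-↭ blacks↭ blacks

mutual
  AllDegsDiv⇒AllDegreesDivisible : ∀ m c t → AllDegsDiv m (degs c t) → AllDegreesDivisible m t
  AllDegsDiv⇒AllDegreesDivisible m c (node xs) div =
    let (vertex , rest) = AllDegsDiv-⊕⁻ (vertexDegs c (suc (length xs))) (degsL c xs) div
    in AllDegsDiv-vertexDegs c _ vertex , AllDegsDiv⇒AllDegreesDivisibleL m c xs rest

  AllDegsDiv⇒AllDegreesDivisibleL : ∀ m c xs → AllDegsDiv m (degsL c xs) → AllDegreesDivisibleL m xs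
  AllDegsDiv⇒AllDegreesDivisibleL m c []             div = tt
  AllDegsDiv⇒AllDegreesDivisibleL m c (nothing ∷ xs) div = AllDegsDiv⇒AllDegreesDivisibleL m c xs div
  AllDegsDiv⇒AllDegreesDivisibleL m c (just t ∷ xs)  div =
    let (first , rest) = AllDegsDiv-⊕⁻ (degs (other c) t) (degsL c xs) div
    in AllDegsDiv⇒AllDegreesDivisible m (other c) t first , AllDegsDiv⇒AllDegreesDivisibleL m c xs rest

halfCharge-other : ∀ c → halfCharge (other c) ≡ - halfCharge c
halfCharge-other white = refl
halfCharge-other black = refl

-- Counting the root half-edge, the charge is the sum over vertices of degree · halfCharge
-- (each edge adds +1 at its white end and -1 at its black end), hence a multiple of m.
mutual
  total-charge-divisible : ∀ m c t → AllDegreesDivisible m t → + m ∣ charge c t + halfCharge c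
  total-charge-divisible m c (node xs) (m∣deg , divs) =
    subst (+ m ∣_) (regroup (chargeL c xs) (halfCharge c) (+ length xs))
      (∣m∣n⇒∣m+n (chargeL-divisible m c xs divs) (∣n⇒∣m*n (halfCharge c) (∣ᵤ⇒∣ m∣deg)))
    where
    regroup : ∀ x h l → x - h * l + h * (1ℤ + l) ≡ x + h
    regroup = solve-∀

  chargeL-divisible : ∀ m c xs → AllDegreesDivisibleL m xs → + m ∣ chargeL c xs - halfCharge c * + length xs
  chargeL-divisible m c []             divs = subst (+ m ∣_) (vanish (halfCharge c)) (∣ᵤ⇒∣ (m ℕ.∣0))
    where
    vanish : ∀ h → 0ℤ ≡ 0ℤ - h * 0ℤ
    vanish = solve-∀
  chargeL-divisible m c (nothing ∷ xs) divs =
    subst (+ m ∣_) (regroup (chargeL c xs) (halfCharge c) (+ length xs)) (chargeL-divisible m c xs divs)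
    where
    regroup : ∀ x h l → x - h * l ≡ h + x - h * (1ℤ + l)
    regroup = solve-∀
  chargeL-divisible m c (just t ∷ xs)  (div , divs) =
    subst (+ m ∣_) eq (∣m∣n⇒∣m+n (total-charge-divisible m (other c) t div) (chargeL-divisible m c xs divs))
    where
    h = halfCharge c
    regroup : ∀ y x h l → y + - h + (x - h * l) ≡ y + x - h * (1ℤ + l)
    regroup = solve-∀
    eq : charge (other c) t + halfCharge (other c) + (chargeL c xs - h * + length xs)
       ≡ charge (other c) t + chargeL c xs - h * (1ℤ + + length xs)
    eq = trans (cong (λ h′ → charge (other c) t + h′ + (chargeL c xs - h * + length xs)) (halfCharge-other c))
               (regroup (charge (other c) t) (chargeL c xs) h (+ length xs))

+≡⇒≡- : ∀ {x y z} → x + y ≡ z → x ≡ z - y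
+≡⇒≡- {x} {y} refl = x≡x+y-y x y
  where
  x≡x+y-y : ∀ x y → x ≡ x + y - y
  x≡x+y-y = solve-∀

complement-nonneg : ∀ {x y} (m : ℕ) → 1 ≤ℕ m → x + y ≡ + m → y ≤ 1ℤ → 0ℤ ≤ x
complement-nonneg m 1≤m x+y≡m y≤1 =
  subst (0ℤ ≤_) (sym (+≡⇒≡- x+y≡m)) (ℤ.i≤j⇒0≤j-i (ℤ.≤-trans y≤1 (+≤+ 1≤m)))

complement-≤1 : ∀ {x y} (m : ℕ) → x + y ≡ + m → 0ℤ ≤ y → + m ∣ y + 1ℤ → x ≤ 1ℤ
complement-≤1 {x} {+ n} m x+y≡m (+≤+ z≤n) m∣y+1 = begin
  x                   ≡⟨ +≡⇒≡- x+y≡m ⟩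
  + m - + n           ≤⟨ ℤ.+-monoˡ-≤ (- + n) (+≤+ m≤1+n) ⟩
  + suc n - + n       ≡⟨ 1+k-k≡1 (+ n) ⟩
  1ℤ                  ∎
  where
  open ℤ.≤-Reasoning
  m≤1+n : m ≤ℕ suc n
  m≤1+n = ℕ.∣⇒≤ (subst (m ℕ.∣_) (ℕ.+-comm n 1) (∣⇒∣ᵤ m∣y+1))
  1+k-k≡1 : ∀ k → 1ℤ + k - k ≡ 1ℤ
  1+k-k≡1 = solve-∀

-- N and P are the two sides of an edge in a tree of total charge m.  In the black case the
-- total charge of P is positive and a multiple of m, hence at least m.
LowerBound-complement : ∀ m → 1 ≤ℕ m → ∀ c N P → charge c N + charge (other c) P ≡ + m →
  LowerBound (other c) P → AllDegreesDivisible m P → LowerBound c N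
LowerBound-complement m 1≤m white N P sum bound divs = complement-nonneg m 1≤m sum bound
LowerBound-complement m 1≤m black N P sum bound divs = complement-≤1 m sum bound (total-charge-divisible m white P divs)

chargeItem : Colour → Maybe Tree → ℤ
chargeItem c nothing  = halfCharge c
chargeItem c (just t) = charge (other c) t

chargeL-++ : ∀ c xs ys → chargeL c (xs ++ ys) ≡ chargeL c xs + chargeL c ys
chargeL-++ c []             ys = sym (ℤ.+-identityˡ _)
chargeL-++ c (nothing ∷ xs) ys =
  trans (cong (_+_ (halfCharge c)) (chargeL-++ c xs ys)) (sym (ℤ.+-assoc (halfCharge c) _ _))
chargeL-++ c (just t ∷ xs)  ys =
  trans (cong (_+_ (charge (other c) t)) (chargeL-++ c xs ys)) (sym (ℤ.+-assoc (charge (other c) t) _ _))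

chargeL-∷ : ∀ c t xs → chargeL c (t ∷ xs) ≡ chargeItem c t + chargeL c xs
chargeL-∷ c nothing  xs = refl
chargeL-∷ c (just t) xs = refl

BlossomItem : Colour → Maybe Tree → Set
BlossomItem c nothing  = ⊤
BlossomItem c (just t) = LowerBound (other c) t × Blossom (other c) t

Blossoms-++⁻ : ∀ c xs ys → Blossoms c (xs ++ ys) → Blossoms c xs × Blossoms c ys
Blossoms-++⁻ c []             ys bl = tt , bl
Blossoms-++⁻ c (nothing ∷ xs) ys bl = Blossoms-++⁻ c xs ys bl
Blossoms-++⁻ c (just t ∷ xs)  ys (bound , bt , bl) =
  let (blx , bly) = Blossoms-++⁻ c xs ys bl in (bound , bt , blx) , bly

Blossoms-++⁺ : ∀ c xs ys → Blossoms c xs → Blossoms c ys → Blossoms c (xs ++ ys)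
Blossoms-++⁺ c []             ys blx bly = bly
Blossoms-++⁺ c (nothing ∷ xs) ys blx bly = Blossoms-++⁺ c xs ys blx bly
Blossoms-++⁺ c (just t ∷ xs)  ys (bound , bt , blx) bly = bound , bt , Blossoms-++⁺ c xs ys blx bly

Blossoms-∷⁺ : ∀ c t xs → BlossomItem c t → Blossoms c xs → Blossoms c (t ∷ xs)
Blossoms-∷⁺ c nothing  xs _           blx = blx
Blossoms-∷⁺ c (just t) xs (bound , bt) blx = bound , bt , blx

AllDegreesDivisibleL-++⁻ : ∀ m xs ys → AllDegreesDivisibleL m (xs ++ ys) →
  AllDegreesDivisibleL m xs × AllDegreesDivisibleL m ys
AllDegreesDivisibleL-++⁻ m []             ys divs = tt , divs
AllDegreesDivisibleL-++⁻ m (nothing ∷ xs) ys divs = AllDegreesDivisibleL-++⁻ m xs ys divs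
AllDegreesDivisibleL-++⁻ m (just t ∷ xs)  ys (div , divs) =
  let (divx , divy) = AllDegreesDivisibleL-++⁻ m xs ys divs in (div , divx) , divy

Blossom-invertPath : ∀ m → 1 ≤ℕ m → ∀ c fs xs ys t →
  chargeItem c t + charge c (plug fs xs ys) ≡ + m → BlossomItem c t →
  Blossom c (plug fs xs ys) → AllDegreesDivisible m (plug fs xs ys) →
  Blossom (colourAt c fs) (node (ys ++ invertPath fs t ∷ xs))
Blossom-invertPath m 1≤m c [] xs ys t total bt bl divs =
  let (blx , bly) = Blossoms-++⁻ c xs (nothing ∷ ys) bl
  in Blossoms-++⁺ c ys (t ∷ xs) bly (Blossoms-∷⁺ c t xs bt blx)
Blossom-invertPath m 1≤m c ((a , q) ∷ fs) xs ys t total bt bl (_ , divs) =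
  Blossom-invertPath m 1≤m (other c) fs xs ys (just N) totalN btN blP divP
  where
  P = plug fs xs ys
  N = node (q ++ t ∷ a)
  blSplit = Blossoms-++⁻ c a (just P ∷ q) bl
  blA = proj₁ blSplit
  boundP = proj₁ (proj₂ blSplit)
  blP = proj₁ (proj₂ (proj₂ blSplit))
  blQ = proj₂ (proj₂ (proj₂ blSplit))
  divP = proj₁ (proj₂ (AllDegreesDivisibleL-++⁻ m a (just P ∷ q) divs))
  regroup : ∀ A Q I X → Q + (I + A) + X ≡ I + (A + (X + Q))
  regroup = solve-∀
  sumNP : charge c N + charge (other c) P ≡ + m
  sumNP = begin
    chargeL c (q ++ t ∷ a) + charge (other c) P
      ≡⟨ cong (_+ charge (other c) P) (trans (chargeL-++ c q (t ∷ a)) (cong (_+_ (chargeL c q)) (chargeL-∷ c t a))) ⟩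
    chargeL c q + (chargeItem c t + chargeL c a) + charge (other c) P
      ≡⟨ regroup (chargeL c a) (chargeL c q) (chargeItem c t) (charge (other c) P) ⟩
    chargeItem c t + (chargeL c a + (charge (other c) P + chargeL c q))
      ≡⟨ cong (_+_ (chargeItem c t)) (chargeL-++ c a (just P ∷ q)) ⟨
    chargeItem c t + charge c (plug ((a , q) ∷ fs) xs ys)
      ≡⟨ total ⟩
    + m
      ∎
    where open ≡-Reasoning
  totalN : charge (other (other c)) N + charge (other c) P ≡ + m
  totalN = subst (λ c′ → charge c′ N + charge (other c) P ≡ + m) (sym (other-involutive c)) sumNP
  btN : LowerBound (other (other c)) N × Blossom (other (other c)) N
  btN = subst (λ c′ → LowerBound c′ N × Blossom c′ N) (sym (other-involutive c))
    (LowerBound-complement m 1≤m c N P sumNP boundP divP , Blossoms-++⁺ c q (t ∷ a) blQ (Blossoms-∷⁺ c t a bt blA))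

Blossom-reroot : ∀ m → 1 ≤ℕ m → ∀ c fs xs ys → charge c (plug fs xs ys) + halfCharge c ≡ + m →
  Blossom c (plug fs xs ys) → AllDegreesDivisible m (plug fs xs ys) → Blossom (colourAt c fs) (reroot fs xs ys)
Blossom-reroot m 1≤m c fs xs ys total =
  Blossom-invertPath m 1≤m c fs xs ys nothing (trans (ℤ.+-comm (halfCharge c) _) total) tt

-- Contour words

symCharge : Sym → ℤ
symCharge bud  = -1ℤ
symCharge leaf = 1ℤ
symCharge root = 1ℤ

wordCharge : List Sym → ℤ
wordCharge []       = 0ℤ
wordCharge (x ∷ ws) = symCharge x + wordCharge ws

wordCharge-++ : ∀ xs ys → wordCharge (xs ++ ys) ≡ wordCharge xs + wordCharge ys
wordCharge-++ []       ys = sym (ℤ.+-identityˡ _)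
wordCharge-++ (x ∷ xs) ys = trans (cong (_+_ (symCharge x)) (wordCharge-++ xs ys)) (sym (ℤ.+-assoc (symCharge x) _ _))

symCharge-halfEdge : ∀ c → symCharge (halfEdge c) ≡ halfCharge c
symCharge-halfEdge white = refl
symCharge-halfEdge black = refl

symCharge-leaf : ∀ {l} → IsLeaf l → symCharge l ≡ 1ℤ
symCharge-leaf isLeaf = refl
symCharge-leaf isRoot = refl

mutual
  charge≡wordCharge : ∀ c t → charge c t ≡ wordCharge (word c t)
  charge≡wordCharge c (node xs) = chargeL≡wordCharge c xs

  chargeL≡wordCharge : ∀ c xs → chargeL c xs ≡ wordCharge (wordL c xs)
  chargeL≡wordCharge c []             = refl
  chargeL≡wordCharge c (nothing ∷ xs) = cong₂ _+_ (sym (symCharge-halfEdge c)) (chargeL≡wordCharge c xs)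
  chargeL≡wordCharge c (just t ∷ xs)  =
    trans (cong₂ _+_ (charge≡wordCharge (other c) t) (chargeL≡wordCharge c xs)) (sym (wordCharge-++ (word (other c) t) _))

wordCharge-match : ∀ xs {l} ys → IsLeaf l → wordCharge (xs ++ bud ∷ l ∷ ys) ≡ wordCharge (xs ++ ys)
wordCharge-match []       ys isLeaf = -1+[1+y]≡y (wordCharge ys)
  where
  -1+[1+y]≡y : ∀ y → -1ℤ + (1ℤ + y) ≡ y
  -1+[1+y]≡y = solve-∀
wordCharge-match []       ys isRoot = wordCharge-match [] ys isLeaf
wordCharge-match (x ∷ xs) ys l = cong (_+_ (symCharge x)) (wordCharge-match xs ys l)

data NonNegSuffixes : List Sym → Set where
  []  : NonNegSuffixes []
  _∷_ : ∀ {x ws} → 0ℤ ≤ wordCharge (x ∷ ws) → NonNegSuffixes ws → NonNegSuffixes (x ∷ ws)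

NonNegSuffixes⇒0≤ : ∀ {ws} → NonNegSuffixes ws → 0ℤ ≤ wordCharge ws
NonNegSuffixes⇒0≤ []      = ℤ.≤-refl
NonNegSuffixes⇒0≤ (0≤ ∷ _) = 0≤

NonNegSuffixes-match : ∀ xs {l} ys → IsLeaf l → NonNegSuffixes (xs ++ bud ∷ l ∷ ys) → NonNegSuffixes (xs ++ ys)
NonNegSuffixes-match []       ys l (_ ∷ _ ∷ nn) = nn
NonNegSuffixes-match (x ∷ xs) ys l (0≤ ∷ nn)    =
  subst (0ℤ ≤_) (cong (_+_ (symCharge x)) (wordCharge-match xs ys l)) 0≤ ∷ NonNegSuffixes-match xs ys l nn

NonNegSuffixes-++⁻ : ∀ xs {ys} → NonNegSuffixes (xs ++ ys) → NonNegSuffixes ys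
NonNegSuffixes-++⁻ []       nn       = nn
NonNegSuffixes-++⁻ (x ∷ xs) (_ ∷ nn) = NonNegSuffixes-++⁻ xs nn

Dyck : List Sym → Set
Dyck ws = wordCharge ws ≡ 0ℤ × NonNegSuffixes ws

data NonPosPrefixes (a : ℤ) : List Sym → Set where
  []  : NonPosPrefixes a []
  _∷_ : ∀ {x ws} → a + symCharge x ≤ 0ℤ → NonPosPrefixes (a + symCharge x) ws → NonPosPrefixes a (x ∷ ws)

NonPosPrefixes⇒NonNegSuffixes : ∀ {a ws} → a ≤ 0ℤ → a + wordCharge ws ≡ 0ℤ → NonPosPrefixes a ws → NonNegSuffixes ws
NonPosPrefixes⇒NonNegSuffixes a≤0 total [] = []
NonPosPrefixes⇒NonNegSuffixes {a} {x ∷ ws} a≤0 total (a+x≤0 ∷ np) =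
  subst (0ℤ ≤_) (sym (+≡⇒≡- (trans (ℤ.+-comm (wordCharge (x ∷ ws)) a) total))) (ℤ.i≤j⇒0≤j-i a≤0)
  ∷ NonPosPrefixes⇒NonNegSuffixes a+x≤0 (trans (ℤ.+-assoc a (symCharge x) _) total) np

NonNegSuffixes⇒NonPosPrefixes : ∀ {a ws} → a ≡ - wordCharge ws → NonNegSuffixes ws → NonPosPrefixes a ws
NonNegSuffixes⇒NonPosPrefixes a≡ [] = []
NonNegSuffixes⇒NonPosPrefixes {a} {x ∷ ws} a≡ (_ ∷ nn) =
  subst (_≤ 0ℤ) (sym a+x≡) (ℤ.neg-mono-≤ (NonNegSuffixes⇒0≤ nn)) ∷ NonNegSuffixes⇒NonPosPrefixes a+x≡ nn
  where
  -[x+w]+x≡-w : ∀ x w → - (x + w) + x ≡ - w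
  -[x+w]+x≡-w = solve-∀
  a+x≡ : a + symCharge x ≡ - wordCharge ws
  a+x≡ = trans (cong (_+ symCharge x) a≡) (-[x+w]+x≡-w (symCharge x) (wordCharge ws))

negativeSuffixStep : Sym → List Sym → Maybe ℕ → Maybe ℕ
negativeSuffixStep x    ws (just n) = just (suc n)
negativeSuffixStep bud  ws nothing with wordCharge ws ℤ.≟ 0ℤ
... | yes _ = just 0
... | no  _ = nothing
negativeSuffixStep leaf ws nothing = nothing
negativeSuffixStep root ws nothing = nothing

-- The position of the bud starting the shortest suffix of charge -1, if there is one.
negativeSuffix : List Sym → Maybe ℕ
negativeSuffix []       = nothing
negativeSuffix (x ∷ ws) = negativeSuffixStep x ws (negativeSuffix ws)

NegativeSuffixView : List Sym → Maybe ℕ → Set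
NegativeSuffixView ws nothing  = NonNegSuffixes ws
NegativeSuffixView ws (just n) = ∃ λ P → ∃ λ S → ws ≡ P ++ bud ∷ S × length P ≡ n × Dyck S

0≤w≢0⇒0≤-1+w : ∀ w → 0ℤ ≤ w → ¬ w ≡ 0ℤ → 0ℤ ≤ -1ℤ + w
0≤w≢0⇒0≤-1+w (+ zero)  _ w≢0 = ⊥-elim (w≢0 refl)
0≤w≢0⇒0≤-1+w (+ suc n) _ _   = +≤+ z≤n

negativeSuffix-view : ∀ ws → NegativeSuffixView ws (negativeSuffix ws)
negativeSuffix-view []       = []
negativeSuffix-view (x ∷ ws) = step x (negativeSuffix ws) (negativeSuffix-view ws)
  where
  1+w≥0 : NonNegSuffixes ws → 0ℤ ≤ 1ℤ + wordCharge ws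
  1+w≥0 nn = ℤ.+-mono-≤ {0ℤ} {1ℤ} (+≤+ z≤n) (NonNegSuffixes⇒0≤ nn)
  step : ∀ x r → NegativeSuffixView ws r → NegativeSuffixView (x ∷ ws) (negativeSuffixStep x ws r)
  step x    (just n) (P , S , ws≡ , len , dyck) = x ∷ P , S , cong (x ∷_) ws≡ , cong suc len , dyck
  step bud  nothing  nn with wordCharge ws ℤ.≟ 0ℤ
  ... | yes w≡0 = [] , ws , refl , refl , w≡0 , nn
  ... | no  w≢0 = 0≤w≢0⇒0≤-1+w (wordCharge ws) (NonNegSuffixes⇒0≤ nn) w≢0 ∷ nn
  step leaf nothing  nn = 1+w≥0 nn ∷ nn
  step root nothing  nn = 1+w≥0 nn ∷ nn

negativeSuffix-NonNegSuffixes : ∀ ws → NonNegSuffixes ws → negativeSuffix ws ≡ nothing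
negativeSuffix-NonNegSuffixes ws nn with negativeSuffix ws | negativeSuffix-view ws
... | nothing | _ = refl
... | just n  | (P , S , refl , _ , w≡0 , _) with NonNegSuffixes⇒0≤ (NonNegSuffixes-++⁻ P nn)
... | 0≤-1+w rewrite w≡0 with 0≤-1+w
... | ()

negativeSuffix-complete : ∀ P S → Dyck S → negativeSuffix (P ++ bud ∷ S) ≡ just (length P)
negativeSuffix-complete []      S (w≡0 , nn) rewrite negativeSuffix-NonNegSuffixes S nn with wordCharge S ℤ.≟ 0ℤ
... | yes _   = refl
... | no  w≢0 = ⊥-elim (w≢0 w≡0)
negativeSuffix-complete (x ∷ P) S dyck rewrite negativeSuffix-complete P S dyck = refl

-- The position of the first half-edge at which the running charge, started at a, reaches 1.
firstPositivePrefix : ℤ → List Sym → Maybe ℕ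
firstPositivePrefix a []       = nothing
firstPositivePrefix a (x ∷ ws) with a + symCharge x ℤ.≟ 1ℤ
... | yes _ = just 0
... | no  _ = Maybe.map suc (firstPositivePrefix (a + symCharge x) ws)

PositivePrefixView : ℤ → List Sym → Maybe ℕ → Set
PositivePrefixView a ws nothing  = a + wordCharge ws ≤ 0ℤ
PositivePrefixView a ws (just n) = ∃ λ P → ∃ λ l → ∃ λ S →
  ws ≡ P ++ l ∷ S × IsLeaf l × length P ≡ n × NonPosPrefixes a P × a + wordCharge P ≡ 0ℤ

reach-one : ∀ a x → a ≤ 0ℤ → a + symCharge x ≡ 1ℤ → a ≡ 0ℤ × IsLeaf x
reach-one (+ zero)     leaf _         _  = refl , isLeaf
reach-one (+ zero)     root _         _  = refl , isRoot
reach-one (+ zero)     bud  _         ()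
reach-one (+ suc n)    x    (+≤+ ())  _
reach-one -[1+ n ]     bud  _         ()
reach-one -[1+ zero ]  leaf _         ()
reach-one -[1+ suc n ] leaf _         ()
reach-one -[1+ zero ]  root _         ()
reach-one -[1+ suc n ] root _         ()

stay-nonpos : ∀ a x → a ≤ 0ℤ → ¬ a + symCharge x ≡ 1ℤ → a + symCharge x ≤ 0ℤ
stay-nonpos (+ zero)     bud  _        _ = -≤+
stay-nonpos (+ zero)     leaf _        ≢1 = ⊥-elim (≢1 refl)
stay-nonpos (+ zero)     root _        ≢1 = ⊥-elim (≢1 refl)
stay-nonpos (+ suc n)    x    (+≤+ ()) _
stay-nonpos -[1+ n ]     bud  _        _ = -≤+
stay-nonpos -[1+ zero ]  leaf _        _ = +≤+ z≤n
stay-nonpos -[1+ suc n ] leaf _        _ = -≤+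
stay-nonpos -[1+ zero ]  root _        _ = +≤+ z≤n
stay-nonpos -[1+ suc n ] root _        _ = -≤+

firstPositivePrefix-view : ∀ a ws → a ≤ 0ℤ → PositivePrefixView a ws (firstPositivePrefix a ws)
firstPositivePrefix-view a [] a≤0 = subst (_≤ 0ℤ) (sym (ℤ.+-identityʳ a)) a≤0
firstPositivePrefix-view a (x ∷ ws) a≤0 with a + symCharge x ℤ.≟ 1ℤ
... | yes a+x≡1 =
  let (a≡0 , l) = reach-one a x a≤0 a+x≡1 in [] , x , ws , refl , l , refl , [] , trans (ℤ.+-identityʳ a) a≡0
... | no  a+x≢1 = shift (firstPositivePrefix (a + symCharge x) ws) (firstPositivePrefix-view (a + symCharge x) ws a+x≤0)
  where
  a+x≤0 = stay-nonpos a x a≤0 a+x≢1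
  shift : ∀ r → PositivePrefixView (a + symCharge x) ws r → PositivePrefixView a (x ∷ ws) (Maybe.map suc r)
  shift nothing  total≤0 = subst (_≤ 0ℤ) (ℤ.+-assoc a (symCharge x) (wordCharge ws)) total≤0
  shift (just n) (P , l , S , ws≡ , isL , len , np , P≡0) =
    x ∷ P , l , S , cong (x ∷_) ws≡ , isL , cong suc len , a+x≤0 ∷ np , trans (sym (ℤ.+-assoc a (symCharge x) _)) P≡0

firstPositivePrefix-complete : ∀ a P {l} S → NonPosPrefixes a P → a + wordCharge P ≡ 0ℤ → IsLeaf l →
  firstPositivePrefix a (P ++ l ∷ S) ≡ just (length P)
firstPositivePrefix-complete a [] S [] total isL with trans (sym (ℤ.+-identityʳ a)) total
firstPositivePrefix-complete .(+ zero) [] S [] total isLeaf | refl = refl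
firstPositivePrefix-complete .(+ zero) [] S [] total isRoot | refl = refl
firstPositivePrefix-complete a (x ∷ P) S (a+x≤0 ∷ np) total isL with a + symCharge x ℤ.≟ 1ℤ
... | yes a+x≡1 with subst (_≤ 0ℤ) a+x≡1 a+x≤0
...   | +≤+ ()
firstPositivePrefix-complete a (x ∷ P) S (a+x≤0 ∷ np) total isL | no _
  rewrite firstPositivePrefix-complete (a + symCharge x) P S np (trans (ℤ.+-assoc a (symCharge x) _) total) isL = refl

-- The matching process

_≟Sym_ : (x y : Sym) → Dec (x ≡ y)
bud  ≟Sym bud  = yes refl
bud  ≟Sym leaf = no λ ()
bud  ≟Sym root = no λ ()
leaf ≟Sym bud  = no λ ()
leaf ≟Sym leaf = yes refl
leaf ≟Sym root = no λ ()
root ≟Sym bud  = no λ ()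
root ≟Sym leaf = no λ ()
root ≟Sym root = yes refl

open import Data.List.Membership.DecPropositional _≟Sym_ using (_∈?_)

root≢halfEdge : ∀ c → ¬ root ≡ halfEdge c
root≢halfEdge white ()
root≢halfEdge black ()

mutual
  root∉word : ∀ c t → ¬ root ∈ word c t
  root∉word c (node xs) = root∉wordL c xs

  root∉wordL : ∀ c xs → ¬ root ∈ wordL c xs
  root∉wordL c (nothing ∷ xs) (here root≡) = root≢halfEdge c root≡
  root∉wordL c (nothing ∷ xs) (there root∈) = root∉wordL c xs root∈
  root∉wordL c (just t ∷ xs)  root∈ with ∈-++⁻ (word (other c) t) root∈
  ... | inj₁ root∈t  = root∉word (other c) t root∈t
  ... | inj₂ root∈xs = root∉wordL c xs root∈xs

data HasNegativeSuffix : List Sym → Set where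
  stop : ∀ {ws} → wordCharge ws ≤ -1ℤ → HasNegativeSuffix ws
  skip : ∀ {x ws} → HasNegativeSuffix ws → HasNegativeSuffix (x ∷ ws)

HasNegativeSuffix-++⁺ : ∀ xs {ys} → HasNegativeSuffix ys → HasNegativeSuffix (xs ++ ys)
HasNegativeSuffix-++⁺ []       neg = neg
HasNegativeSuffix-++⁺ (x ∷ xs) neg = skip (HasNegativeSuffix-++⁺ xs neg)

1+w≤-1⇒w≤-1 : ∀ w → 1ℤ + w ≤ -1ℤ → w ≤ -1ℤ
1+w≤-1⇒w≤-1 -[1+ n ] _ = -≤- z≤n

HasNegativeSuffix-match : ∀ xs {l} ys → IsLeaf l → HasNegativeSuffix (xs ++ bud ∷ l ∷ ys) → HasNegativeSuffix (xs ++ ys)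
HasNegativeSuffix-match []       ys l (stop ≤-1) = stop (subst (_≤ -1ℤ) (wordCharge-match [] ys l) ≤-1)
HasNegativeSuffix-match []       ys l (skip (stop ≤-1)) rewrite symCharge-leaf l = stop (1+w≤-1⇒w≤-1 (wordCharge ys) ≤-1)
HasNegativeSuffix-match []       ys l (skip (skip neg)) = neg
HasNegativeSuffix-match (x ∷ xs) ys l (stop ≤-1) =
  stop (subst (_≤ -1ℤ) (cong (_+_ (symCharge x)) (wordCharge-match xs ys l)) ≤-1)
HasNegativeSuffix-match (x ∷ xs) ys l (skip neg) = skip (HasNegativeSuffix-match xs ys l neg)

wordCharge≤-1⇒bud∈ : ∀ ws → wordCharge ws ≤ -1ℤ → bud ∈ ws
wordCharge≤-1⇒bud∈ (bud  ∷ ws) _    = here refl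
wordCharge≤-1⇒bud∈ (leaf ∷ ws) ≤-1 = there (wordCharge≤-1⇒bud∈ ws (1+w≤-1⇒w≤-1 (wordCharge ws) ≤-1))
wordCharge≤-1⇒bud∈ (root ∷ ws) ≤-1 = there (wordCharge≤-1⇒bud∈ ws (1+w≤-1⇒w≤-1 (wordCharge ws) ≤-1))

HasNegativeSuffix⇒bud∈ : ∀ {ws} → HasNegativeSuffix ws → bud ∈ ws
HasNegativeSuffix⇒bud∈ (stop ≤-1) = wordCharge≤-1⇒bud∈ _ ≤-1
HasNegativeSuffix⇒bud∈ (skip neg) = there (HasNegativeSuffix⇒bud∈ neg)

++-∷-split : ∀ (xs ys A C : List Sym) x → xs ++ ys ≡ A ++ x ∷ C →
  (∃ λ M → xs ≡ A ++ x ∷ M × C ≡ M ++ ys) ⊎ (∃ λ M → A ≡ xs ++ M × ys ≡ M ++ x ∷ C)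
++-∷-split []       ys A       C x eq = inj₂ (A , refl , eq)
++-∷-split (y ∷ xs) ys []      C x eq with ∷-injective eq
... | refl , eq′ = inj₁ (xs , refl , sym eq′)
++-∷-split (y ∷ xs) ys (z ∷ A) C x eq with ∷-injective eq
... | refl , eq′ with ++-∷-split xs ys A C x eq′
... | inj₁ (M , xs≡ , C≡) = inj₁ (M , cong (y ∷_) xs≡ , C≡)
... | inj₂ (M , A≡ , ys≡) = inj₂ (M , cong (y ∷_) A≡ , ys≡)

-- Reading the cyclic word from just after the root, some suffix ending just before the root
-- has negative charge.  This survives every matching step and forbids a terminal word.
RootBlocked : List Sym → Set
RootBlocked v = ∀ A C → v ≡ A ++ root ∷ C → HasNegativeSuffix (C ++ A)

RootBlocked-step : ∀ {v v′} → MatchStep v v′ → RootBlocked v → RootBlocked v′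
RootBlocked-step (inner as bs {l} isL) blocked A C v′≡ with ++-∷-split as bs A C root v′≡
... | inj₁ (M , refl , refl) =
  subst HasNegativeSuffix (sym (++-assoc M bs A))
    (HasNegativeSuffix-match M (bs ++ A) isL (subst HasNegativeSuffix (++-assoc M (bud ∷ l ∷ bs) A)
      (blocked A (M ++ bud ∷ l ∷ bs) (++-assoc A (root ∷ M) (bud ∷ l ∷ bs)))))
... | inj₂ (M , refl , refl) =
  subst HasNegativeSuffix (++-assoc C as M)
    (HasNegativeSuffix-match (C ++ as) M isL (subst HasNegativeSuffix (sym (++-assoc C as (bud ∷ l ∷ M)))
      (blocked (as ++ bud ∷ l ∷ M) C (sym (++-assoc as (bud ∷ l ∷ M) (root ∷ C))))))
RootBlocked-step (wrap ms {l} isL) blocked A C refl =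
  HasNegativeSuffix-match C A isL (subst HasNegativeSuffix (++-assoc C (bud ∷ []) (l ∷ A))
    (blocked (l ∷ A) (C ++ bud ∷ []) (cong (l ∷_) (++-assoc A (root ∷ C) (bud ∷ [])))))

RootBlocked-star : ∀ {v v′} → Star MatchStep v v′ → RootBlocked v → RootBlocked v′
RootBlocked-star ε          blocked = blocked
RootBlocked-star (s ◅ steps) blocked = RootBlocked-star steps (RootBlocked-step s blocked)

MatchablePair : List Sym → Set
MatchablePair ws =
  (∃ λ A → ∃ λ l → ∃ λ C → ws ≡ A ++ bud ∷ l ∷ C × IsLeaf l) ⊎ (∃ λ A → ws ≡ A ++ bud ∷ [])

≢bud⇒IsLeaf : ∀ x → ¬ x ≡ bud → IsLeaf x
≢bud⇒IsLeaf bud  ≢bud = ⊥-elim (≢bud refl)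
≢bud⇒IsLeaf leaf _    = isLeaf
≢bud⇒IsLeaf root _    = isRoot

bud∈⇒MatchablePair : ∀ ws → bud ∈ ws → MatchablePair ws
bud∈⇒MatchablePair (x ∷ ws) bud∈ with bud ∈? ws
... | yes bud∈ws with bud∈⇒MatchablePair ws bud∈ws
...   | inj₁ (A , l , C , refl , isL) = inj₁ (x ∷ A , l , C , refl , isL)
...   | inj₂ (A , refl)               = inj₂ (x ∷ A , refl)
bud∈⇒MatchablePair (x ∷ ws) (here refl) | no bud∉ws with ws
... | []     = inj₂ ([] , refl)
... | y ∷ ys = inj₁ ([] , y , ys , refl , ≢bud⇒IsLeaf y λ y≡bud → bud∉ws (here (sym y≡bud)))
bud∈⇒MatchablePair (x ∷ ws) (there bud∈ws) | no bud∉ws = ⊥-elim (bud∉ws bud∈ws)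

MatchStep-at : ∀ {v w} → v ≡ w → ∃ (MatchStep w) → ∃ (MatchStep v)
MatchStep-at refl step = step

rotation-MatchStep : ∀ A C → MatchablePair (C ++ A) → ∃ (MatchStep (A ++ root ∷ C))
rotation-MatchStep A C (inj₁ (X , l , Y , eq , isL)) with ++-∷-split C A X (l ∷ Y) bud eq
... | inj₁ ([] , refl , refl) =
  MatchStep-at (cong (l ∷_) (sym (++-assoc Y (root ∷ X) (bud ∷ [])))) (_ , wrap (Y ++ root ∷ X) isL)
... | inj₁ (.l ∷ M , refl , refl) =
  MatchStep-at (sym (++-assoc A (root ∷ X) (bud ∷ l ∷ M))) (_ , inner (A ++ root ∷ X) M isL)
... | inj₂ (M , refl , refl) =
  MatchStep-at (++-assoc M (bud ∷ l ∷ Y) (root ∷ C)) (_ , inner M (Y ++ root ∷ C) isL)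
rotation-MatchStep A C (inj₂ (X , eq)) with ++-∷-split C A X [] bud eq
... | inj₁ ([] , refl , refl) = _ , wrap X isRoot
... | inj₂ (M , refl , refl) = MatchStep-at (++-assoc M (bud ∷ []) (root ∷ C)) (_ , inner M C isRoot)

RootBlocked⇒root∉Terminal : ∀ {ys} → Terminal ys → RootBlocked ys → ¬ root ∈ ys
RootBlocked⇒root∉Terminal terminal blocked root∈ with ∈-∃++ root∈
... | A , C , refl with rotation-MatchStep A C (bud∈⇒MatchablePair (C ++ A) (HasNegativeSuffix⇒bud∈ (blocked A C refl)))
... | _ , step = terminal _ step

HasNegativeSuffix⇒¬single : ∀ ws → ¬ root ∈ ws → HasNegativeSuffix ws →
  ∀ {ys} → Star MatchStep (root ∷ ws) ys → Terminal ys → ¬ root ∈ ys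
HasNegativeSuffix⇒¬single ws root∉ws neg steps terminal =
  RootBlocked⇒root∉Terminal terminal (RootBlocked-star steps blocked)
  where
  blocked : RootBlocked (root ∷ ws)
  blocked []      C eq with ∷-injective eq
  ... | _ , refl = subst HasNegativeSuffix (sym (++-identityʳ C)) neg
  blocked (a ∷ A) C eq with ∷-injective eq
  ... | _ , refl = ⊥-elim (root∉ws (∈-++⁺ʳ A (here refl)))

MatchStep⇒bud∈ : ∀ {v v′} → MatchStep v v′ → bud ∈ v
MatchStep⇒bud∈ (inner as bs _) = ∈-++⁺ʳ as (here refl)
MatchStep⇒bud∈ (wrap ms _)     = there (∈-++⁺ʳ ms (here refl))

length-match : ∀ (X Y : List Sym) l → length (X ++ bud ∷ l ∷ Y) ≡ suc (suc (length (X ++ Y)))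
length-match X Y l = begin
  length (X ++ bud ∷ l ∷ Y)         ≡⟨ length-++ X ⟩
  length X ℕ.+ suc (suc (length Y)) ≡⟨ ℕ.+-suc (length X) (suc (length Y)) ⟩
  suc (length X ℕ.+ suc (length Y)) ≡⟨ cong suc (ℕ.+-suc (length X) (length Y)) ⟩
  suc (suc (length X ℕ.+ length Y)) ≡⟨ cong (suc ∘ suc) (length-++ X) ⟨
  suc (suc (length (X ++ Y)))       ∎
  where open ≡-Reasoning

SingleRoot : List Sym → Set
SingleRoot ws = ∃ λ ys → Star MatchStep (root ∷ ws) ys × Terminal ys × root ∈ ys

-- Greedily match adjacent bud-leaf pairs inside ws: as ws does not end with a bud, the root
-- is never matched.  The length bound k is fuel for the recursion.
NonNegSuffixes⇒SingleRoot : ∀ k ws → length ws ≤ℕ k → NonNegSuffixes ws → SingleRoot ws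
NonNegSuffixes⇒SingleRoot k ws len nn with bud ∈? ws
... | no bud∉ws = root ∷ ws , ε , terminal , here refl
  where
  terminal : Terminal (root ∷ ws)
  terminal _ step with MatchStep⇒bud∈ step
  ... | there bud∈ws = bud∉ws bud∈ws
... | yes bud∈ws with bud∈⇒MatchablePair ws bud∈ws
...   | inj₂ (A , refl) with NonNegSuffixes⇒0≤ (NonNegSuffixes-++⁻ A nn)
...     | ()
NonNegSuffixes⇒SingleRoot (suc k) ws len nn | yes _ | inj₁ (X , l , Y , refl , isL) =
  let (ys , steps , terminal , root∈) = NonNegSuffixes⇒SingleRoot k (X ++ Y) shorter (NonNegSuffixes-match X Y isL nn)
  in ys , inner (root ∷ X) Y isL ◅ steps , terminal , root∈
  where
  shorter : length (X ++ Y) ≤ℕ k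
  shorter = ℕ.≤-trans (ℕ.n≤1+n _) (ℕ.≤-pred (subst (_≤ℕ suc k) (length-match X Y l) len))
NonNegSuffixes⇒SingleRoot zero ws len nn | yes _ | inj₁ (X , l , Y , refl , isL)
  with subst (_≤ℕ 0) (length-match X Y l) len
... | ()

-- The bijection

-- node [] is a junk value, returned only for an index beyond the contour word.
rerootFocus : Focus ⊎ ℕ → Tree
rerootFocus (inj₁ (fs , xs , ys)) = reroot fs xs ys
rerootFocus (inj₂ _)              = node []

rerootAt : Tree → ℕ → Tree
rerootAt t n = rerootFocus (locateIn [] (children t) n)

halfEdge-injective : ∀ c d → halfEdge c ≡ halfEdge d → c ≡ d
halfEdge-injective white white _ = refl
halfEdge-injective black black _ = refl

record Rerooting (c c′ : Colour) (X R : Tree) (P S : List Sym) : Set where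
  field
    word-rerooted    : word c′ R ≡ S ++ halfEdge c ∷ P
    rerootAt-back    : rerootAt R (length S) ≡ X
    degs-rerooted    : SameDegs (degs c X) (degs c′ R)
    Blossom-rerooted : ∀ m → 1 ≤ℕ m → charge c X + halfCharge c ≡ + m →
                       Blossom c X → AllDegreesDivisible m X → Blossom c′ R

rerooting-at-located : ∀ {c M P s S} (loc : Located c M P s S) →
  Rerooting c (colourAt c (Located.frames loc)) (node M) (rerootAt (node M) (length P)) P S
rerooting-at-located {c} {M} {P} {s} {S} loc =
  subst (λ R → Rerooting c c′ (node M) R P S) (sym (cong rerootFocus locate≡)) (record
    { word-rerooted    = trans (word-reroot c fs xs ys) (cong₂ (λ S′ P′ → S′ ++ halfEdge c ∷ P′) suffix≡ prefix≡)
    ; rerootAt-back    = back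
    ; degs-rerooted    = subst (λ N → SameDegs (degs c N) (degs c′ (reroot fs xs ys))) plugged (degs-reroot c fs xs ys)
    ; Blossom-rerooted = λ m 1≤m total bl divs → Blossom-reroot m 1≤m c fs xs ys
        (subst (λ N → charge c N + halfCharge c ≡ + m) (sym plugged) total)
        (subst (Blossom c) (sym plugged) bl) (subst (AllDegreesDivisible m) (sym plugged) divs)
    })
  where
  open Located loc renaming (frames to fs; before to xs; after to ys)
  c′ = colourAt c fs
  plugged : plug fs xs ys ≡ node M
  plugged = cong node plug≡
  gs = proj₁ (oldRootFocus fs xs ys)
  us = proj₁ (proj₂ (oldRootFocus fs xs ys))
  vs = proj₂ (proj₂ (oldRootFocus fs xs ys))
  back : rerootAt (reroot fs xs ys) (length S) ≡ node M
  back = begin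
    rerootFocus (locateIn [] (children (reroot fs xs ys)) (length S))
      ≡⟨ cong₂ (λ N n → rerootFocus (locateIn [] (children N) n)) (sym (plug-oldRootFocus fs xs ys))
           (cong length (sym (trans (prefixWord-oldRootFocus c fs xs ys) suffix≡))) ⟩
    rerootFocus (locateIn [] (plugChildren gs us vs) (length (prefixWord c′ gs us)))
      ≡⟨ cong rerootFocus (locateIn-plug c′ gs us vs) ⟩
    reroot gs us vs
      ≡⟨ reroot-oldRootFocus fs xs ys ⟩
    plug fs xs ys
      ≡⟨ plugged ⟩
    node M
      ∎
    where open ≡-Reasoning

rerooting-at-halfEdge : ∀ c c′ X P S → word c X ≡ P ++ halfEdge c′ ∷ S →
  Rerooting c c′ X (rerootAt X (length P)) P S
rerooting-at-halfEdge c c′ (node M) P S word≡ =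
  subst (λ d → Rerooting c d (node M) (rerootAt (node M) (length P)) P S)
    (halfEdge-injective _ c′ (Located.halfEdge≡ loc)) (rerooting-at-located loc)
  where
  loc = locate-complete c M P (halfEdge c′) S word≡

Hat : ℕ → ℤ → Colour → Tree → Set
Hat m i c X = Blossom c X × charge c X ≡ i × AllDegsDiv m (degs c X)

WHat⇒Hat : ∀ {m i} t → WHat m i t → Hat m i white (fromW t)
WHat⇒Hat t (bl , ch≡ , divs) =
  Equivalence.to (BlossomW⇔ t) bl , trans (sym (chW-fromW t)) ch≡ , subst (AllDegsDiv _) (degsW-fromW t) divs

BHat⇒Hat : ∀ {m i} u → BHat m i u → Hat m i black (fromB u)
BHat⇒Hat u (bl , ch≡ , divs) =
  Equivalence.to (BlossomB⇔ u) bl , trans (sym (chB-fromB u)) ch≡ , subst (AllDegsDiv _) (degsB-fromB u) divs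

Hat⇒WHat : ∀ {m i} t → Hat m i white (fromW t) → WHat m i t
Hat⇒WHat t (bl , ch≡ , divs) =
  Equivalence.from (BlossomW⇔ t) bl , trans (chW-fromW t) ch≡ , subst (AllDegsDiv _) (sym (degsW-fromW t)) divs

Hat⇒BHat : ∀ {m i} u → Hat m i black (fromB u) → BHat m i u
Hat⇒BHat u (bl , ch≡ , divs) =
  Equivalence.from (BlossomB⇔ u) bl , trans (chB-fromB u) ch≡ , subst (AllDegsDiv _) (sym (degsB-fromB u)) divs

Hat⇒WHat-toW : ∀ {m i} X → Hat m i white X → WHat m i (toW X)
Hat⇒WHat-toW {m} {i} X hat = Hat⇒WHat (toW X) (subst (Hat m i white) (sym (fromW-toW X)) hat)

Hat⇒BHat-toB : ∀ {m i} X → Hat m i black X → BHat m i (toB X)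
Hat⇒BHat-toB {m} {i} X hat = Hat⇒BHat (toB X) (subst (Hat m i black) (sym (fromB-toB X)) hat)

halfCharge≡symCharge-other : ∀ c → - halfCharge c ≡ symCharge (halfEdge (other c))
halfCharge≡symCharge-other c = trans (sym (halfCharge-other c)) (sym (symCharge-halfEdge (other c)))

charge-rerooted : ∀ m c X R P S → word c X ≡ P ++ halfEdge (other c) ∷ S → word (other c) R ≡ S ++ halfEdge c ∷ P →
  charge c X ≡ + m - halfCharge c → charge (other c) R ≡ + m + halfCharge c
charge-rerooted m c X R P S wordX wordR chargeX = begin
  charge (other c) R                   ≡⟨ charge≡wordCharge (other c) R ⟩
  wordCharge (word (other c) R)        ≡⟨ cong wordCharge wordR ⟩
  wordCharge (S ++ halfEdge c ∷ P)     ≡⟨ wordCharge-++ S _ ⟩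
  wS + (symCharge (halfEdge c) + wP)   ≡⟨ cong (λ x → wS + (x + wP)) (symCharge-halfEdge c) ⟩
  wS + (h + wP)                        ≡⟨ regroup wP wS h ⟩
  wP + (- h + wS) + (h + h)            ≡⟨ cong (λ x → wP + (x + wS) + (h + h)) (halfCharge≡symCharge-other c) ⟩
  wP + wordCharge (halfEdge (other c) ∷ S) + (h + h)
                                       ≡⟨ cong (_+ (h + h)) (wordCharge-++ P _) ⟨
  wordCharge (P ++ halfEdge (other c) ∷ S) + (h + h)
                                       ≡⟨ cong (λ ws → wordCharge ws + (h + h)) wordX ⟨
  wordCharge (word c X) + (h + h)      ≡⟨ cong (_+ (h + h)) (trans (sym (charge≡wordCharge c X)) chargeX) ⟩
  + m - h + (h + h)                    ≡⟨ m-h+[h+h]≡m+h (+ m) h ⟩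
  + m + h                              ∎
  where
  open ≡-Reasoning
  h = halfCharge c
  wP = wordCharge P
  wS = wordCharge S
  regroup : ∀ p s h → s + (h + p) ≡ p + (- h + s) + (h + h)
  regroup = solve-∀
  m-h+[h+h]≡m+h : ∀ m h → m - h + (h + h) ≡ m + h
  m-h+[h+h]≡m+h = solve-∀

Rerooting-Hat : ∀ m → 1 ≤ℕ m → ∀ c X R P S → Rerooting c (other c) X R P S → word c X ≡ P ++ halfEdge (other c) ∷ S →
  Hat m (+ m - halfCharge c) c X → Hat m (+ m + halfCharge c) (other c) R
Rerooting-Hat m 1≤m c X R P S rerooting word≡ (bl , ch≡ , divs) =
  Blossom-rerooted m 1≤m total bl (AllDegsDiv⇒AllDegreesDivisible m c X divs) ,
  charge-rerooted m c X R P S word≡ word-rerooted ch≡ ,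
  AllDegsDiv-resp-SameDegs degs-rerooted divs
  where
  open Rerooting rerooting
  m-h+h≡m : ∀ m h → m - h + h ≡ m
  m-h+h≡m = solve-∀
  total : charge c X + halfCharge c ≡ + m
  total = trans (cong (_+ halfCharge c) ch≡) (m-h+h≡m (+ m) (halfCharge c))

toUnionAt : W → Maybe ℕ → W ⊎ B
toUnionAt t nothing  = inj₁ t
toUnionAt t (just n) = inj₂ (toB (rerootAt (fromW t) n))

toUnion : W → W ⊎ B
toUnion t = toUnionAt t (negativeSuffix (word white (fromW t)))

-- w [] is a junk value: the index is always found on B̂_{m+1}.
fromUnionAt : B → Maybe ℕ → W
fromUnionAt u nothing  = w []
fromUnionAt u (just n) = toW (rerootAt (fromB u) n)

fromUnion : W ⊎ B → W
fromUnion (inj₁ t) = t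
fromUnion (inj₂ u) = fromUnionAt u (firstPositivePrefix 0ℤ (word black (fromB u)))

toUnion-just : ∀ t {n} → negativeSuffix (word white (fromW t)) ≡ just n → toUnion t ≡ inj₂ (toB (rerootAt (fromW t) n))
toUnion-just t found rewrite found = refl

fromUnion-just : ∀ u {n} → firstPositivePrefix 0ℤ (word black (fromB u)) ≡ just n →
  fromUnion (inj₂ u) ≡ toW (rerootAt (fromB u) n)
fromUnion-just u found rewrite found = refl

NonNegSuffixes⇒Balanced : ∀ m → 1 ≤ℕ m → ∀ t → chW t ≡ + m - 1ℤ → NonNegSuffixes (word white (fromW t)) → Balanced t
NonNegSuffixes⇒Balanced m 1≤m t ch≡ nn =
  subst (1ℤ ≤_) (sym (trans (cong (_+ 1ℤ) ch≡) (m-1+1≡m (+ m)))) (+≤+ 1≤m) ,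
  NonNegSuffixes⇒SingleRoot _ (wordW t) ℕ.≤-refl (subst NonNegSuffixes (sym (wordW-fromW t)) nn)
  where
  m-1+1≡m : ∀ m → m - 1ℤ + 1ℤ ≡ m
  m-1+1≡m = solve-∀

Balanced⇒toUnionAt≡inj₁ : ∀ t → Balanced t → ∀ r → NegativeSuffixView (word white (fromW t)) r →
  toUnionAt t r ≡ inj₁ t
Balanced⇒toUnionAt≡inj₁ t _ nothing _ = refl
Balanced⇒toUnionAt≡inj₁ t (_ , ys , steps , terminal , root∈) (just _) (P , S , word≡ , _ , w≡0 , _) =
  ⊥-elim (HasNegativeSuffix⇒¬single (wordW t) root∉ negative steps terminal root∈)
  where
  root∉ : ¬ root ∈ wordW t
  root∉ = root∉word white (fromW t) ∘ subst (root ∈_) (wordW-fromW t)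
  negative : HasNegativeSuffix (wordW t)
  negative = subst HasNegativeSuffix (sym (trans (wordW-fromW t) word≡))
    (HasNegativeSuffix-++⁺ P (stop (subst (λ x → -1ℤ + x ≤ -1ℤ) (sym w≡0) ℤ.≤-refl)))

toUnion-reroot : ∀ m → 1 ≤ℕ m → ∀ t → WHat m (+ m - 1ℤ) t → ∀ P S → word white (fromW t) ≡ P ++ bud ∷ S → Dyck S →
  let u = toB (rerootAt (fromW t) (length P)) in
  BHat m (+ m + 1ℤ) u × fromUnion (inj₂ u) ≡ t × SameDegs (degsW t) (degsB u)
toUnion-reroot m 1≤m t p P S word≡ (w≡0 , nn) =
  Hat⇒BHat-toB R (Rerooting-Hat m 1≤m white X R P S rerooting word≡ (WHat⇒Hat t p)) , back , sameDegs
  where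
  X = fromW t
  R = rerootAt X (length P)
  rerooting = rerooting-at-halfEdge white black X P S word≡
  open Rerooting rerooting
  found : firstPositivePrefix 0ℤ (word black (fromB (toB R))) ≡ just (length S)
  found = trans (cong (firstPositivePrefix 0ℤ) (trans (cong (word black) (fromB-toB R)) word-rerooted))
    (firstPositivePrefix-complete 0ℤ S P (NonNegSuffixes⇒NonPosPrefixes (sym (cong -_ w≡0)) nn)
      (trans (ℤ.+-identityˡ _) w≡0) isLeaf)
  back : fromUnion (inj₂ (toB R)) ≡ t
  back = begin
    fromUnion (inj₂ (toB R))                  ≡⟨ fromUnion-just (toB R) found ⟩
    toW (rerootAt (fromB (toB R)) (length S)) ≡⟨ cong (λ Y → toW (rerootAt Y (length S))) (fromB-toB R) ⟩
    toW (rerootAt R (length S))               ≡⟨ cong toW rerootAt-back ⟩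
    toW X                                     ≡⟨ toW-fromW t ⟩
    t                                         ∎
    where open ≡-Reasoning
  sameDegs : SameDegs (degsW t) (degsB (toB R))
  sameDegs = begin
    degsW t                   ≡⟨ degsW-fromW t ⟩
    degs white X              ≈⟨ degs-rerooted ⟩
    degs black R              ≡⟨ cong (degs black) (fromB-toB R) ⟨
    degs black (fromB (toB R)) ≡⟨ degsB-fromB (toB R) ⟨
    degsB (toB R)             ∎
    where open SetoidReasoning degsSetoid

IsLeaf-in-word : ∀ c X P {l} S → word c X ≡ P ++ l ∷ S → IsLeaf l → l ≡ leaf
IsLeaf-in-word c X P S word≡ isLeaf = refl
IsLeaf-in-word c X P S word≡ isRoot = ⊥-elim (root∉word c X (subst (root ∈_) (sym word≡) (∈-++⁺ʳ P (here refl))))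

fromUnion-reroot : ∀ m → 1 ≤ℕ m → ∀ u → BHat m (+ m + 1ℤ) u → ∀ P S → word black (fromB u) ≡ P ++ leaf ∷ S →
  NonPosPrefixes 0ℤ P → 0ℤ + wordCharge P ≡ 0ℤ →
  let t = toW (rerootAt (fromB u) (length P)) in WHat m (+ m - 1ℤ) t × toUnion t ≡ inj₂ u
fromUnion-reroot m 1≤m u p P S word≡ np total =
  Hat⇒WHat-toW R (Rerooting-Hat m 1≤m black Y R P S rerooting word≡ (BHat⇒Hat u p)) , back
  where
  Y = fromB u
  R = rerootAt Y (length P)
  rerooting = rerooting-at-halfEdge black white Y P S word≡
  open Rerooting rerooting
  found : negativeSuffix (word white (fromW (toW R))) ≡ just (length S)
  found = trans (cong negativeSuffix (trans (cong (word white) (fromW-toW R)) word-rerooted))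
    (negativeSuffix-complete S P (trans (sym (ℤ.+-identityˡ _)) total , NonPosPrefixes⇒NonNegSuffixes ℤ.≤-refl total np))
  back : toUnion (toW R) ≡ inj₂ u
  back = begin
    toUnion (toW R)                                    ≡⟨ toUnion-just (toW R) found ⟩
    inj₂ (toB (rerootAt (fromW (toW R)) (length S)))   ≡⟨ cong (λ X → inj₂ (toB (rerootAt X (length S)))) (fromW-toW R) ⟩
    inj₂ (toB (rerootAt R (length S)))                 ≡⟨ cong (inj₂ ∘ toB) rerootAt-back ⟩
    inj₂ (toB Y)                                       ≡⟨ cong inj₂ (toB-fromB u) ⟩
    inj₂ u                                             ∎
    where open ≡-Reasoning

Balanced⇒toUnion≡inj₁ : ∀ t → Balanced t → toUnion t ≡ inj₁ t
Balanced⇒toUnion≡inj₁ t balanced = Balanced⇒toUnionAt≡inj₁ t balanced _ (negativeSuffix-view (word white (fromW t)))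

toUnionAt-correct : ∀ m → 1 ≤ℕ m → ∀ t → WHat m (+ m - 1ℤ) t → ∀ r → NegativeSuffixView (word white (fromW t)) r →
  InUnion m (+ m - 1ℤ) (+ m + 1ℤ) (toUnionAt t r) × fromUnion (toUnionAt t r) ≡ t × SameDegs (degsW t) (degsU (toUnionAt t r))
toUnionAt-correct m 1≤m t p nothing nn =
  (p , NonNegSuffixes⇒Balanced m 1≤m t (proj₁ (proj₂ p)) nn) , refl , SameDegs-refl
toUnionAt-correct m 1≤m t p (just .(length P)) (P , S , word≡ , refl , dyck) =
  toUnion-reroot m 1≤m t p P S word≡ dyck

toUnion-correct : ∀ m → 1 ≤ℕ m → ∀ t → WHat m (+ m - 1ℤ) t →
  InUnion m (+ m - 1ℤ) (+ m + 1ℤ) (toUnion t) × fromUnion (toUnion t) ≡ t × SameDegs (degsW t) (degsU (toUnion t))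
toUnion-correct m 1≤m t p = toUnionAt-correct m 1≤m t p _ (negativeSuffix-view (word white (fromW t)))

m+1≰0 : ∀ m → ¬ + m + 1ℤ ≤ 0ℤ
m+1≰0 m (+≤+ m+1≤0) with subst (ℕ._≤ 0) (ℕ.+-comm m 1) m+1≤0
... | ()

fromUnionAt-correct : ∀ m → 1 ≤ℕ m → ∀ u → BHat m (+ m + 1ℤ) u → ∀ r → PositivePrefixView 0ℤ (word black (fromB u)) r →
  WHat m (+ m - 1ℤ) (fromUnionAt u r) × toUnion (fromUnionAt u r) ≡ inj₂ u
fromUnionAt-correct m 1≤m u p nothing total≤0 = ⊥-elim (m+1≰0 m (subst (_≤ 0ℤ) total total≤0))
  where
  total : 0ℤ + wordCharge (word black (fromB u)) ≡ + m + 1ℤ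
  total = trans (ℤ.+-identityˡ _) (trans (sym (charge≡wordCharge black (fromB u))) (proj₁ (proj₂ (BHat⇒Hat u p))))
fromUnionAt-correct m 1≤m u p (just .(length P)) (P , l , S , word≡ , isL , refl , np , total)
  with IsLeaf-in-word black (fromB u) P S word≡ isL
... | refl = fromUnion-reroot m 1≤m u p P S word≡ np total

fromUnion-correct : ∀ m → 1 ≤ℕ m → ∀ u → BHat m (+ m + 1ℤ) u →
  WHat m (+ m - 1ℤ) (fromUnion (inj₂ u)) × toUnion (fromUnion (inj₂ u)) ≡ inj₂ u
fromUnion-correct m 1≤m u p = fromUnionAt-correct m 1≤m u p _ (firstPositivePrefix-view 0ℤ (word black (fromB u)) ℤ.≤-refl)

theorem13 : (m : ℕ) → 1 ≤ℕ m →
    DegPresBij (WHat m (+ m - 1ℤ)) (InUnion m (+ m - 1ℤ) (+ m + 1ℤ))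
theorem13 m 1≤m = record
  { to      = toUnion
  ; from    = fromUnion
  ; to-Q    = λ t p → proj₁ (toUnion-correct m 1≤m t p)
  ; from-P  = from-P
  ; from-to = λ t p → proj₁ (proj₂ (toUnion-correct m 1≤m t p))
  ; to-from = to-from
  ; to-degs = λ t p → proj₂ (proj₂ (toUnion-correct m 1≤m t p))
  }
  where
  from-P : ∀ v → InUnion m (+ m - 1ℤ) (+ m + 1ℤ) v → WHat m (+ m - 1ℤ) (fromUnion v)
  from-P (inj₁ t) (p , _) = p
  from-P (inj₂ u) q       = proj₁ (fromUnion-correct m 1≤m u q)
  to-from : ∀ v → InUnion m (+ m - 1ℤ) (+ m + 1ℤ) v → toUnion (fromUnion v) ≡ v
  to-from (inj₁ t) (_ , balanced) = Balanced⇒toUnion≡inj₁ t balanced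
  to-from (inj₂ u) q              = proj₂ (fromUnion-correct m 1≤m u q)
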